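{- For every $n\ge2$, the signed descent set polynomial $Q^\pm_n(t)$ is divisible by the cyclotomic polynomial $\Phi_4(t)=t^2+1$.
   Context: A signed permutation of size $n$ is a word $\pi_1\cdots\pi_n$ with each $\pi_i\in\{\pm1,\dots,\pm n\}$ such that $|\pi_1|\cdots|\pi_n|$ is a permutation of $[n]$; with $\pi_0=0$, its descent set is $\{i\in[n]:\pi_{i-1}>\pi_i\}$. $\beta^\pm_n(S)$ is the number of signed permutations of size $n$ with descent set $S\subseteq[n]$, and $Q^\pm_n(t)=\sum_{S\subseteq[n]}t^{\beta^\pm_n(S)}$. -}

module Defs where

open import Data.Nat using (ℕ; zero; suc)
open import Data.Integer using (ℤ; +_; -_; _<?_; ∣_∣) renaming (_+_ to _+ℤ_; _*_ to _*ℤ_)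
open import Data.Bool using (Bool; true; false)
import Data.Bool as Bool
open import Data.List using (List; []; _∷_; map; concatMap; filter; length; upTo; foldr; and)
open import Data.List.Relation.Unary.Any using (any?)
open import Data.Vec using (Vec; []; _∷_; toList)
import Data.Vec.Properties as VecP
open import Data.Product using (∃; _×_)
open import Relation.Binary.PropositionalEquality using (_≡_)
open import Relation.Nullary.Decidable using (⌊_⌋; does)
import Data.Nat as ℕ

-- Polynomials with integer coefficients, as coefficient lists
-- (constant term first).

Poly : Set
Poly = List ℤ

coeff : Poly → ℕ → ℤ
coeff []      _       = + 0
coeff (a ∷ p) zero    = a
coeff (a ∷ p) (suc k) = coeff p k

_⊕_ : Poly → Poly → Poly
[]      ⊕ q       = q
(a ∷ p) ⊕ []      = a ∷ p
(a ∷ p) ⊕ (b ∷ q) = (a +ℤ b) ∷ (p ⊕ q)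

_⊛_ : Poly → Poly → Poly
[]      ⊛ q = []
(a ∷ p) ⊛ q = map (a *ℤ_) q ⊕ (+ 0 ∷ (p ⊛ q))

monomial : ℕ → Poly
monomial zero    = + 1 ∷ []
monomial (suc k) = + 0 ∷ monomial k

_∣ₚ_ : Poly → Poly → Set
d ∣ₚ p = ∃ λ q → ∀ k → coeff p k ≡ coeff (d ⊛ q) k

Φ₄ : Poly
Φ₄ = + 1 ∷ + 0 ∷ + 1 ∷ []

words : (m : ℕ) → {A : Set} → List A → List (Vec A m)
words zero    L = [] ∷ []
words (suc m) L = concatMap (λ a → map (a ∷_) (words m L)) L

letters : ℕ → List ℤ
letters n = concatMap (λ j → + suc j ∷ - (+ suc j) ∷ []) (upTo n)

-- |π₁| ⋯ |πₙ| is a permutation of [n]: every j ∈ [n] occurs among the |πᵢ|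
-- (a word of length n with letters in [n] covering [n] is a permutation)
isSignedPerm : (n : ℕ) → Vec ℤ n → Bool
isSignedPerm n w =
  and (map (λ j → does (any? (λ x → ∣ x ∣ ℕ.≟ suc j) (toList w))) (upTo n))

signedPerms : (n : ℕ) → List (Vec ℤ n)
signedPerms n = filter (λ w → Bool.T? (isSignedPerm n w)) (words n (letters n))

-- Descent sets.  A subset S ⊆ [n] is a Vec Bool n whose i-th entry
-- (0-based) says whether i+1 ∈ S.

descAfter : ℤ → {m : ℕ} → Vec ℤ m → Vec Bool m
descAfter prev []      = []
descAfter prev (x ∷ w) = does (x <? prev) ∷ descAfter x w

descentSet : {n : ℕ} → Vec ℤ n → Vec Bool n
descentSet = descAfter (+ 0)

subsets : (n : ℕ) → List (Vec Bool n)
subsets n = words n (true ∷ false ∷ [])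

βˢ : (n : ℕ) → Vec Bool n → ℕ
βˢ n S = length (filter (λ w → VecP.≡-dec Bool._≟_ (descentSet w) S) (signedPerms n))

Qˢ : ℕ → Poly
Qˢ n = foldr (λ S acc → monomial (βˢ n S) ⊕ acc) [] (subsets n)

-- The hyperoctahedral group B₂ acts on signed permutations by relabelling the letters
-- ±1, ±2; every orbit has eight elements and exactly one canonical member, in which the
-- letters of absolute value at most 2 are 1 and then 2. For a canonical word B 1 C 2 D,
-- with B, C, D made of letters of absolute value at least 3, relabelling changes the descent
-- set only at the position of 1 when B is empty and at the position of 2 when C is empty,
-- and each of these two positions is a descent for exactly four of the eight relabellings.
-- Modulo 4 only the orbits with B = C = [] survive, which gives
-- β±ₙ(s₁s₂S) ≡ β±₂(s₁s₂) · β±ₙ₋₂(S) (mod 4). As β±₂ takes the values 1, 3, 3, 1, every β±ₙ(S)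
-- is odd and flipping s₁ changes it by 2 modulo 4. Grouping the subsets S in pairs that differ
-- in s₁ writes Q±ₙ(t) as a sum of binomials t^a + t^b with b ≡ a + 2 (mod 4), each divisible
-- by t² + 1.

module Submission where

open import Defs
open import Data.Nat using (ℕ; _≤_)
open import Data.Nat as ℕ using (zero; suc; _+_; _*_; _∸_; _<_; _%_; z≤n; s≤s)
import Data.Nat.Properties as ℕP
import Data.Nat.DivMod as ℕD
open import Data.Integer as ℤ using (ℤ; +_; -[1+_]; -_; ∣_∣; _<?_)
import Data.Integer.Properties as ℤP
open import Data.Bool as Bool using (Bool; true; false; _∧_; _∨_; if_then_else_)
import Data.Bool.Properties as BoolP
open import Data.List as List using (List; []; _∷_; _++_; map; concatMap; filter; length; upTo; applyUpTo)
open import Data.Bool.ListAction using (and)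
import Data.List.Properties as ListP
open import Data.List.Relation.Unary.All using (All; []; _∷_)
open import Data.List.Relation.Unary.All.Properties using (all-filter)
open import Data.List.Relation.Unary.Any using (Any; here; there; any?)
open import Data.List.Membership.Propositional using (_∈_; _─_; find)
import Data.List.Membership.Propositional.Properties as ∈P
open import Data.Vec as Vec using (Vec; []; _∷_; toList)
import Data.Vec.Properties as VecP
open import Data.Product using (∃-syntax; _×_; _,_; proj₁; proj₂)
open import Data.Sum using (_⊎_; inj₁; inj₂)
open import Function using (_∘_; mk⇔; Equivalence)
open import Relation.Binary.PropositionalEquality
open import Relation.Nullary using (Dec; yes; no; does; ¬_)
open import Relation.Nullary.Decidable using (_⊎-dec_)
open import Data.Empty using (⊥-elim)
open import Relation.Unary using (Decidable)
import Algebra.Properties.CommutativeSemigroup as CommSemigroupProperties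

open CommSemigroupProperties ℕP.+-commutativeSemigroup using (interchange; x∙yz≈y∙xz)
module ℤ+ = CommSemigroupProperties ℤP.+-commutativeSemigroup
open import Data.Integer.Solver using () renaming (module +-*-Solver to ℤSolver)

∑ : {A : Set} → (A → ℕ) → List A → ℕ
∑ f []       = 0
∑ f (x ∷ xs) = f x + ∑ f xs

-- The body of ∑[ x ← xs ] extends as far to the right as possible.
infix 5 ∑
syntax ∑ (λ x → e) xs = ∑[ x ← xs ] e

𝟙 : Bool → ℕ
𝟙 true  = 1
𝟙 false = 0

module _ {A : Set} where

  ∑-++ : (f : A → ℕ) (xs ys : List A) → ∑ f (xs ++ ys) ≡ ∑ f xs + ∑ f ys
  ∑-++ f []       ys = refl
  ∑-++ f (x ∷ xs) ys = trans (cong (_+_ (f x)) (∑-++ f xs ys)) (sym (ℕP.+-assoc (f x) _ _))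

  ∑-cong : {f g : A → ℕ} (xs : List A) → (∀ x → f x ≡ g x) → ∑ f xs ≡ ∑ g xs
  ∑-cong []       f≗g = refl
  ∑-cong (x ∷ xs) f≗g = cong₂ _+_ (f≗g x) (∑-cong xs f≗g)

  ∑-zero : {f : A → ℕ} (xs : List A) → (∀ x → f x ≡ 0) → ∑ f xs ≡ 0
  ∑-zero []       f≗0 = refl
  ∑-zero (x ∷ xs) f≗0 = cong₂ _+_ (f≗0 x) (∑-zero xs f≗0)

  ∑-+ : (f g : A → ℕ) (xs : List A) → ∑[ x ← xs ] (f x + g x) ≡ ∑ f xs + ∑ g xs
  ∑-+ f g []       = refl
  ∑-+ f g (x ∷ xs) = trans (cong (_+_ (f x + g x)) (∑-+ f g xs)) (interchange (f x) (g x) _ _)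

  ∑-*ˡ : (c : ℕ) (f : A → ℕ) (xs : List A) → ∑[ x ← xs ] (c * f x) ≡ c * ∑ f xs
  ∑-*ˡ c f []       = sym (ℕP.*-zeroʳ c)
  ∑-*ˡ c f (x ∷ xs) = trans (cong (_+_ (c * f x)) (∑-*ˡ c f xs)) (sym (ℕP.*-distribˡ-+ c (f x) _))

  ∑-%-cong : (d : ℕ) .{{_ : ℕ.NonZero d}} {f g : A → ℕ} (xs : List A) →
             (∀ x → f x % d ≡ g x % d) → ∑ f xs % d ≡ ∑ g xs % d
  ∑-%-cong d []       f≡g = refl
  ∑-%-cong d {f} {g} (x ∷ xs) f≡g = begin
    (f x + ∑ f xs) % d           ≡⟨ ℕD.%-distribˡ-+ (f x) (∑ f xs) d ⟩
    (f x % d + ∑ f xs % d) % d   ≡⟨ cong₂ (λ a b → (a + b) % d) (f≡g x) (∑-%-cong d xs f≡g) ⟩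
    (g x % d + ∑ g xs % d) % d   ≡⟨ ℕD.%-distribˡ-+ (g x) (∑ g xs) d ⟨
    (g x + ∑ g xs) % d           ∎
    where open ≡-Reasoning

module _ {A B : Set} where

  ∑-map : (f : B → ℕ) (g : A → B) (xs : List A) → ∑ f (map g xs) ≡ ∑ (f ∘ g) xs
  ∑-map f g []       = refl
  ∑-map f g (x ∷ xs) = cong (_+_ (f (g x))) (∑-map f g xs)

  ∑-concatMap : (f : B → ℕ) (g : A → List B) (xs : List A) →
                ∑ f (concatMap g xs) ≡ ∑[ x ← xs ] ∑ f (g x)
  ∑-concatMap f g []       = refl
  ∑-concatMap f g (x ∷ xs) = trans (∑-++ f (g x) (concatMap g xs)) (cong (_+_ (∑ f (g x))) (∑-concatMap f g xs))

  ∑-comm : (f : A → B → ℕ) (xs : List A) (ys : List B) →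
           ∑[ x ← xs ] ∑[ y ← ys ] f x y ≡ ∑[ y ← ys ] ∑[ x ← xs ] f x y
  ∑-comm f []       ys = sym (∑-zero ys (λ _ → refl))
  ∑-comm f (x ∷ xs) ys = trans (cong (_+_ (∑ (f x) ys)) (∑-comm f xs ys)) (sym (∑-+ (f x) _ ys))

module _ {A : Set} where

  length-filter-filter : {P Q : A → Set} (P? : Decidable P) (Q? : Decidable Q) (xs : List A) →
    length (filter Q? (filter P? xs)) ≡ ∑[ x ← xs ] 𝟙 (does (P? x)) * 𝟙 (does (Q? x))
  length-filter-filter P? Q? []       = refl
  length-filter-filter P? Q? (x ∷ xs) with does (P? x)
  ... | false = length-filter-filter P? Q? xs
  ... | true with does (Q? x)
  ...   | false = length-filter-filter P? Q? xs
  ...   | true  = cong suc (length-filter-filter P? Q? xs)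

  ∑-zero-All : {P : A → Set} {f : A → ℕ} {xs : List A} → All P xs → (∀ x → P x → f x ≡ 0) → ∑ f xs ≡ 0
  ∑-zero-All []         f≡0 = refl
  ∑-zero-All (px ∷ pxs) f≡0 = cong₂ _+_ (f≡0 _ px) (∑-zero-All pxs f≡0)

  ∑-words-suc : ∀ m (L : List A) (F : Vec A (suc m) → ℕ) →
                ∑ F (words (suc m) L) ≡ ∑[ a ← L ] ∑[ w ← words m L ] F (a ∷ w)
  ∑-words-suc m L F = trans (∑-concatMap F _ L) (∑-cong L (λ a → ∑-map F (a ∷_) (words m L)))

  ∑-words-permute : (σ : A → A) (L : List A) → (∀ f → ∑ (f ∘ σ) L ≡ ∑ f L) →
                    ∀ m (F : Vec A m → ℕ) → ∑ (F ∘ Vec.map σ) (words m L) ≡ ∑ F (words m L)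
  ∑-words-permute σ L σ-perm zero    F = refl
  ∑-words-permute σ L σ-perm (suc m) F = begin
    ∑ (F ∘ Vec.map σ) (words (suc m) L)                          ≡⟨ ∑-words-suc m L _ ⟩
    ∑[ a ← L ] ∑[ w ← words m L ] F (σ a ∷ Vec.map σ w)         ≡⟨ ∑-cong L (λ a → ∑-words-permute σ L σ-perm m (F ∘ (σ a ∷_))) ⟩
    ∑[ a ← L ] ∑[ w ← words m L ] F (σ a ∷ w)                   ≡⟨ σ-perm (λ a → ∑[ w ← words m L ] F (a ∷ w)) ⟩
    ∑[ a ← L ] ∑[ w ← words m L ] F (a ∷ w)                     ≡⟨ ∑-words-suc m L F ⟨
    ∑ F (words (suc m) L)                                        ∎
    where open ≡-Reasoning

  ∑-words-++-vanishing : {P : A → Set} (Ls Lb : List A) → All P Ls → ∀ m (H : Vec A m → ℕ) →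
    (∀ w → Any P (toList w) → H w ≡ 0) → ∑ H (words m (Ls ++ Lb)) ≡ ∑ H (words m Lb)
  ∑-words-++-vanishing Ls Lb PLs zero    H H≡0 = refl
  ∑-words-++-vanishing Ls Lb PLs (suc m) H H≡0 = begin
    ∑ H (words (suc m) (Ls ++ Lb))              ≡⟨ ∑-words-suc m (Ls ++ Lb) H ⟩
    ∑ G (Ls ++ Lb)                              ≡⟨ ∑-++ G Ls Lb ⟩
    ∑ G Ls + ∑ G Lb                             ≡⟨ cong (_+ ∑ G Lb) (∑-zero-All PLs (λ a Pa → ∑-zero (words m (Ls ++ Lb)) (λ w → H≡0 (a ∷ w) (here Pa)))) ⟩
    ∑ G Lb                                      ≡⟨ ∑-cong Lb (λ a → ∑-words-++-vanishing Ls Lb PLs m (H ∘ (a ∷_)) (λ w Pw → H≡0 (a ∷ w) (there Pw))) ⟩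
    ∑[ a ← Lb ] ∑[ w ← words m Lb ] H (a ∷ w)  ≡⟨ ∑-words-suc m Lb H ⟨
    ∑ H (words (suc m) Lb)                      ∎
    where
    open ≡-Reasoning
    G : A → ℕ
    G a = ∑[ w ← words m (Ls ++ Lb) ] H (a ∷ w)

module _ {A B : Set} where

  ∑-words-map : (f : A → B) (L : List A) → ∀ m (F : Vec B m → ℕ) →
                ∑ F (words m (map f L)) ≡ ∑ (F ∘ Vec.map f) (words m L)
  ∑-words-map f L zero    F = refl
  ∑-words-map f L (suc m) F = begin
    ∑ F (words (suc m) (map f L))                                  ≡⟨ ∑-words-suc m (map f L) F ⟩
    ∑[ b ← map f L ] ∑[ w ← words m (map f L) ] F (b ∷ w)          ≡⟨ ∑-map _ f L ⟩
    ∑[ a ← L ] ∑[ w ← words m (map f L) ] F (f a ∷ w)              ≡⟨ ∑-cong L (λ a → ∑-words-map f L m (F ∘ (f a ∷_))) ⟩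
    ∑[ a ← L ] ∑[ w ← words m L ] F (f a ∷ Vec.map f w)            ≡⟨ ∑-words-suc m L (F ∘ Vec.map f) ⟨
    ∑ (F ∘ Vec.map f) (words (suc m) L)                            ∎
    where open ≡-Reasoning

has : ℕ → List ℤ → Bool
has k l = does (any? (λ x → ∣ x ∣ ℕ.≟ k) l)

-- isSignedPerm n w unfolds to signedPermᵇ n (toList w).
signedPermᵇ : ℕ → List ℤ → Bool
signedPermᵇ n l = and (map (λ j → has (suc j) l) (upTo n))

descents : ℤ → List ℤ → List Bool
descents prev []      = []
descents prev (x ∷ l) = does (x <? prev) ∷ descents x l

_==_ : List Bool → List Bool → Bool
xs == ys = does (ListP.≡-dec Bool._≟_ xs ys)

descAfter≟-toList : ∀ {m} p (w : Vec ℤ m) (S : Vec Bool m) →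
                    does (VecP.≡-dec Bool._≟_ (descAfter p w) S) ≡ (descents p (toList w) == toList S)
descAfter≟-toList p []      []      = refl
descAfter≟-toList p (x ∷ w) (s ∷ S) = cong (does (does (x <? p) Bool.≟ s) ∧_) (descAfter≟-toList x w S)

βsummand : ℕ → List Bool → List ℤ → ℕ
βsummand n S l = 𝟙 (signedPermᵇ n l) * 𝟙 (descents (+ 0) l == S)

βˢ-as-∑ : ∀ n S → βˢ n S ≡ ∑[ w ← words n (letters n) ] βsummand n (toList S) (toList w)
βˢ-as-∑ n S = trans (length-filter-filter _ _ (words n (letters n)))
  (∑-cong (words n (letters n)) (λ w → cong (λ b → 𝟙 (isSignedPerm n w) * 𝟙 b) (descAfter≟-toList (+ 0) w S)))

shift₂ : ℤ → ℤ
shift₂ (+ zero)  = + zero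
shift₂ (+ suc k) = + (3 + k)
shift₂ -[1+ k ]  = -[1+ (2 + k) ]

letters-+2 : ∀ m → letters (2 + m) ≡ + 1 ∷ -[1+ 0 ] ∷ + 2 ∷ -[1+ 1 ] ∷ map shift₂ (letters m)
letters-+2 m = cong (λ ls → + 1 ∷ -[1+ 0 ] ∷ + 2 ∷ -[1+ 1 ] ∷ ls)
  (trans (cong (concatMap pair) (sym (ListP.map-upTo (λ k → 2 + k) m))) (shift-pairs (upTo m)))
  where
  pair : ℕ → List ℤ
  pair j = + suc j ∷ - (+ suc j) ∷ []
  shift-pairs : ∀ js → concatMap pair (map (λ k → 2 + k) js) ≡ map shift₂ (concatMap pair js)
  shift-pairs []       = refl
  shift-pairs (j ∷ js) = cong (λ ls → + (3 + j) ∷ -[1+ (2 + j) ] ∷ ls) (shift-pairs js)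

∑-letters-+2 : ∀ m (f : ℤ → ℕ) →
  ∑ f (letters (2 + m)) ≡ f (+ 1) + (f -[1+ 0 ] + (f (+ 2) + (f -[1+ 1 ] + ∑ (f ∘ shift₂) (letters m))))
∑-letters-+2 m f = trans (cong (∑ f) (letters-+2 m))
  (cong (λ r → f (+ 1) + (f -[1+ 0 ] + (f (+ 2) + (f -[1+ 1 ] + r)))) (∑-map f shift₂ (letters m)))

-- Small and big letters, and the action of B₂

data Small : ℤ → Set where
  one⁺ : Small (+ 1)
  one⁻ : Small -[1+ 0 ]
  two⁺ : Small (+ 2)
  two⁻ : Small -[1+ 1 ]

data Big : ℤ → Set where
  big⁺ : ∀ k → Big (+ (3 + k))
  big⁻ : ∀ k → Big -[1+ (2 + k) ]

small? : Decidable Small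
small? (+ 0)                  = no λ ()
small? (+ 1)                  = yes one⁺
small? (+ 2)                  = yes two⁺
small? (+ suc (suc (suc k)))  = no λ ()
small? -[1+ 0 ]               = yes one⁻
small? -[1+ 1 ]               = yes two⁻
small? -[1+ suc (suc k) ]     = no λ ()

big? : Decidable Big
big? (+ 0)                  = no λ ()
big? (+ 1)                  = no λ ()
big? (+ 2)                  = no λ ()
big? (+ suc (suc (suc k)))  = yes (big⁺ k)
big? -[1+ 0 ]               = no λ ()
big? -[1+ 1 ]               = no λ ()
big? -[1+ suc (suc k) ]     = yes (big⁻ k)

¬Small-shift₂ : ∀ x → ¬ Small (shift₂ x)
¬Small-shift₂ (+ zero)  ()
¬Small-shift₂ (+ suc k) ()
¬Small-shift₂ -[1+ k ]  ()

record B₂ : Set where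
  constructor ⟨_,_,_⟩
  field
    swaps negates₁ negates₂ : Bool

open B₂ using (swaps)

allB₂ : List B₂
allB₂ = ⟨ false , false , false ⟩ ∷ ⟨ false , false , true ⟩ ∷ ⟨ false , true , false ⟩ ∷ ⟨ false , true , true ⟩
      ∷ ⟨ true  , false , false ⟩ ∷ ⟨ true  , false , true ⟩ ∷ ⟨ true  , true , false ⟩ ∷ ⟨ true  , true , true ⟩ ∷ []

swapIf : Bool → ℕ → ℕ
swapIf s 1 = if s then 2 else 1
swapIf s 2 = if s then 1 else 2
swapIf s k = k

negateIf : Bool → ℤ → ℤ
negateIf false x = x
negateIf true  x = - x

image₁ image₂ : B₂ → ℤ
image₁ ⟨ s , e₁ , e₂ ⟩ = negateIf e₁ (+ swapIf s 1)
image₂ ⟨ s , e₁ , e₂ ⟩ = negateIf e₂ (+ swapIf s 2)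

act : B₂ → ℤ → ℤ
act g (+ 1)    = image₁ g
act g -[1+ 0 ] = - image₁ g
act g (+ 2)    = image₂ g
act g -[1+ 1 ] = - image₂ g
act g x        = x

inv : B₂ → B₂
inv ⟨ false , e₁ , e₂ ⟩ = ⟨ false , e₁ , e₂ ⟩
inv ⟨ true  , e₁ , e₂ ⟩ = ⟨ true  , e₂ , e₁ ⟩

act-neg : ∀ g x → act g (- x) ≡ - act g x
act-neg g (+ 0)                 = refl
act-neg g (+ 1)                 = refl
act-neg g (+ 2)                 = refl
act-neg g (+ suc (suc (suc k))) = refl
act-neg g -[1+ 0 ]              = sym (ℤP.neg-involutive (image₁ g))
act-neg g -[1+ 1 ]              = sym (ℤP.neg-involutive (image₂ g))
act-neg g -[1+ suc (suc k) ]    = refl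

act-inv-images : ∀ g → act g (image₁ (inv g)) ≡ + 1 × act g (image₂ (inv g)) ≡ + 2
act-inv-images ⟨ false , false , false ⟩ = refl , refl
act-inv-images ⟨ false , false , true  ⟩ = refl , refl
act-inv-images ⟨ false , true  , false ⟩ = refl , refl
act-inv-images ⟨ false , true  , true  ⟩ = refl , refl
act-inv-images ⟨ true  , false , false ⟩ = refl , refl
act-inv-images ⟨ true  , false , true  ⟩ = refl , refl
act-inv-images ⟨ true  , true  , false ⟩ = refl , refl
act-inv-images ⟨ true  , true  , true  ⟩ = refl , refl

act-inv : ∀ g x → act g (act (inv g) x) ≡ x
act-inv g (+ 0)                 = refl
act-inv g (+ 1)                 = proj₁ (act-inv-images g)
act-inv g (+ 2)                 = proj₂ (act-inv-images g)
act-inv g (+ suc (suc (suc k))) = refl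
act-inv g -[1+ 0 ]              = trans (act-neg g (image₁ (inv g))) (cong -_ (proj₁ (act-inv-images g)))
act-inv g -[1+ 1 ]              = trans (act-neg g (image₂ (inv g))) (cong -_ (proj₂ (act-inv-images g)))
act-inv g -[1+ suc (suc k) ]    = refl

act-Big : ∀ g {x} → Big x → act g x ≡ x
act-Big g (big⁺ k) = refl
act-Big g (big⁻ k) = refl

act-shift₂ : ∀ g x → act g (shift₂ x) ≡ shift₂ x
act-shift₂ g (+ zero)  = refl
act-shift₂ g (+ suc k) = refl
act-shift₂ g -[1+ k ]  = refl

Small-image₁ : ∀ g → Small (image₁ g)
Small-image₁ ⟨ false , false , _ ⟩ = one⁺
Small-image₁ ⟨ false , true  , _ ⟩ = one⁻
Small-image₁ ⟨ true  , false , _ ⟩ = two⁺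
Small-image₁ ⟨ true  , true  , _ ⟩ = two⁻

Small-image₂ : ∀ g → Small (image₂ g)
Small-image₂ ⟨ false , _ , false ⟩ = two⁺
Small-image₂ ⟨ false , _ , true  ⟩ = two⁻
Small-image₂ ⟨ true  , _ , false ⟩ = one⁺
Small-image₂ ⟨ true  , _ , true  ⟩ = one⁻

∣negateIf∣ : ∀ e x → ∣ negateIf e x ∣ ≡ ∣ x ∣
∣negateIf∣ false x = refl
∣negateIf∣ true  x = ℤP.∣-i∣≡∣i∣ x

∣act∣ : ∀ g x → ∣ act g x ∣ ≡ swapIf (swaps g) ∣ x ∣
∣act∣ g                  (+ 0)                 = refl
∣act∣ ⟨ s , e₁ , e₂ ⟩ (+ 1)                 = ∣negateIf∣ e₁ (+ swapIf s 1)
∣act∣ ⟨ s , e₁ , e₂ ⟩ (+ 2)                 = ∣negateIf∣ e₂ (+ swapIf s 2)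
∣act∣ g                  (+ suc (suc (suc k))) = refl
∣act∣ ⟨ s , e₁ , e₂ ⟩ -[1+ 0 ]              = trans (ℤP.∣-i∣≡∣i∣ (image₁ ⟨ s , e₁ , e₂ ⟩)) (∣negateIf∣ e₁ (+ swapIf s 1))
∣act∣ ⟨ s , e₁ , e₂ ⟩ -[1+ 1 ]              = trans (ℤP.∣-i∣≡∣i∣ (image₂ ⟨ s , e₁ , e₂ ⟩)) (∣negateIf∣ e₂ (+ swapIf s 2))
∣act∣ g                  -[1+ suc (suc k) ]    = refl

swapIf-involutive : ∀ s k → swapIf s (swapIf s k) ≡ k
swapIf-involutive false 1                 = refl
swapIf-involutive true  1                 = refl
swapIf-involutive false 2                 = refl
swapIf-involutive true  2                 = refl
swapIf-involutive s     0                 = refl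
swapIf-involutive s     (suc (suc (suc k))) = refl

swapIf-≡ᵇ : ∀ s a k → (swapIf s a ℕ.≡ᵇ k) ≡ (a ℕ.≡ᵇ swapIf s k)
swapIf-≡ᵇ s a k = BoolP.⇔→≡ (mk⇔ (to-≡ᵇ ∘ moved ∘ from-≡ᵇ) (to-≡ᵇ ∘ moved′ ∘ from-≡ᵇ))
  where
  from-≡ᵇ : ∀ {m n} → (m ℕ.≡ᵇ n) ≡ true → m ≡ n
  from-≡ᵇ {m} {n} e = ℕP.≡ᵇ⇒≡ m n (Equivalence.from BoolP.T-≡ e)
  to-≡ᵇ : ∀ {m n} → m ≡ n → (m ℕ.≡ᵇ n) ≡ true
  to-≡ᵇ {m} {n} e = Equivalence.to BoolP.T-≡ (ℕP.≡⇒≡ᵇ m n e)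
  moved : swapIf s a ≡ k → a ≡ swapIf s k
  moved e = trans (sym (swapIf-involutive s a)) (cong (swapIf s) e)
  moved′ : a ≡ swapIf s k → swapIf s a ≡ k
  moved′ e = trans (cong (swapIf s) e) (swapIf-involutive s k)

has-act : ∀ g k l → has k (map (act g) l) ≡ has (swapIf (swaps g) k) l
has-act g k []      = refl
has-act g k (x ∷ l) =
  cong₂ _∨_ (trans (cong (ℕ._≡ᵇ k) (∣act∣ g x)) (swapIf-≡ᵇ (swaps g) ∣ x ∣ k)) (has-act g k l)

signedPermᵇ-act : ∀ g m l → signedPermᵇ (2 + m) (map (act g) l) ≡ signedPermᵇ (2 + m) l
signedPermᵇ-act g m l =
  trans (cong and (ListP.map-cong (λ j → has-act g (suc j) l) (upTo (2 + m)))) (first-two (swaps g))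
  where
  tail : (ℕ → ℕ) → List Bool
  tail σ = map (λ j → has (σ (suc j)) l) (applyUpTo (λ k → 2 + k) m)
  tail-swapIf : ∀ s → tail (swapIf s) ≡ tail (λ k → k)
  tail-swapIf s = trans (ListP.map-applyUpTo _ _ m) (sym (ListP.map-applyUpTo _ _ m))
  first-two : ∀ s → has (swapIf s 1) l ∧ (has (swapIf s 2) l ∧ and (tail (swapIf s))) ≡ signedPermᵇ (2 + m) l
  first-two false = cong (λ t → has 1 l ∧ (has 2 l ∧ and t)) (tail-swapIf false)
  first-two true  = trans (cong (λ t → has 2 l ∧ (has 1 l ∧ and t)) (tail-swapIf true))
                          (∧-left-comm (has 2 l) (has 1 l) _)
    where
    ∧-left-comm : ∀ a b c → a ∧ (b ∧ c) ≡ b ∧ (a ∧ c)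
    ∧-left-comm true  b c = refl
    ∧-left-comm false b c = sym (BoolP.∧-zeroʳ b)

∑-negation-pair : (f : ℤ → ℕ) → ∀ e x → f (negateIf e x) + f (- negateIf e x) ≡ f x + f (- x)
∑-negation-pair f false x = refl
∑-negation-pair f true  x = trans (cong (λ y → f (- x) + f y) (ℤP.neg-involutive x)) (ℕP.+-comm (f (- x)) (f x))

∑-letters-act : ∀ g m (f : ℤ → ℕ) → ∑ (f ∘ act g) (letters (2 + m)) ≡ ∑ f (letters (2 + m))
∑-letters-act g@(⟨ s , e₁ , e₂ ⟩) m f = begin
  ∑ (f ∘ act g) (letters (2 + m))
    ≡⟨ ∑-letters-+2 m (f ∘ act g) ⟩
  f u + (f (- u) + (f v + (f (- v) + ∑ (f ∘ act g ∘ shift₂) (letters m))))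
    ≡⟨ regroup (f u) (f (- u)) (f v) (f (- v)) _ ⟩
  (f u + f (- u)) + ((f v + f (- v)) + ∑ (f ∘ act g ∘ shift₂) (letters m))
    ≡⟨ cong₂ (λ a r → a + r) (∑-negation-pair f e₁ (+ swapIf s 1))
             (cong₂ _+_ (∑-negation-pair f e₂ (+ swapIf s 2)) (∑-cong (letters m) (cong f ∘ act-shift₂ g))) ⟩
  pair (swapIf s 1) + (pair (swapIf s 2) + R)
    ≡⟨ unswap s ⟩
  pair 1 + (pair 2 + R)
    ≡⟨ regroup (f (+ 1)) (f -[1+ 0 ]) (f (+ 2)) (f -[1+ 1 ]) R ⟨
  f (+ 1) + (f -[1+ 0 ] + (f (+ 2) + (f -[1+ 1 ] + R)))
    ≡⟨ ∑-letters-+2 m f ⟨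
  ∑ f (letters (2 + m)) ∎
  where
  open ≡-Reasoning
  u = image₁ g
  v = image₂ g
  R = ∑ (f ∘ shift₂) (letters m)
  pair : ℕ → ℕ
  pair k = f (+ k) + f (- (+ k))
  regroup : ∀ a b c d r → a + (b + (c + (d + r))) ≡ (a + b) + ((c + d) + r)
  regroup a b c d r = trans (sym (ℕP.+-assoc a b _)) (cong (_+_ (a + b)) (sym (ℕP.+-assoc c d r)))
  unswap : ∀ s → pair (swapIf s 1) + (pair (swapIf s 2) + R) ≡ pair 1 + (pair 2 + R)
  unswap false = refl
  unswap true  = x∙yz≈y∙xz (pair 2) (pair 1) R

Small-neg : ∀ {x} → Small x → Small (- x)
Small-neg one⁺ = one⁻
Small-neg one⁻ = one⁺
Small-neg two⁺ = two⁻
Small-neg two⁻ = two⁺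

Small-act : ∀ g {x} → Small x → Small (act g x)
Small-act g one⁺ = Small-image₁ g
Small-act g one⁻ = Small-neg (Small-image₁ g)
Small-act g two⁺ = Small-image₂ g
Small-act g two⁻ = Small-neg (Small-image₂ g)

act-nonSmall : ∀ g {x} → ¬ Small x → act g x ≡ x
act-nonSmall g {+ 0}                 ¬s = refl
act-nonSmall g {+ 1}                 ¬s = ⊥-elim (¬s one⁺)
act-nonSmall g {+ 2}                 ¬s = ⊥-elim (¬s two⁺)
act-nonSmall g {+ suc (suc (suc k))} ¬s = refl
act-nonSmall g { -[1+ 0 ] }          ¬s = ⊥-elim (¬s one⁻)
act-nonSmall g { -[1+ 1 ] }          ¬s = ⊥-elim (¬s two⁻)
act-nonSmall g { -[1+ suc (suc k) ] } ¬s = refl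

smalls : List ℤ → List ℤ
smalls = filter small?

smalls-act : ∀ g l → smalls (map (act g) l) ≡ map (act g) (smalls l)
smalls-act g []      = refl
smalls-act g (x ∷ l) with small? x
... | yes sx = trans (ListP.filter-accept small? (Small-act g sx)) (cong (act g x ∷_) (smalls-act g l))
... | no ¬sx = trans (cong (smalls ∘ (_∷ map (act g) l)) (act-nonSmall g ¬sx)) (trans (ListP.filter-reject small? ¬sx) (smalls-act g l))

is12? : ∀ l → Dec (l ≡ + 1 ∷ + 2 ∷ [])
is12? l = ListP.≡-dec ℤ._≟_ l (+ 1 ∷ + 2 ∷ [])

canonical? : ∀ l → Dec (smalls l ≡ + 1 ∷ + 2 ∷ [])
canonical? l = is12? (smalls l)

∑-is12-orbit : ∀ {x y} → Small x → Small y → has 1 (x ∷ y ∷ []) ≡ true → has 2 (x ∷ y ∷ []) ≡ true →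
               ∑[ g ← allB₂ ] 𝟙 (does (is12? (act g x ∷ act g y ∷ []))) ≡ 1
∑-is12-orbit one⁺ two⁺ _  _  = refl
∑-is12-orbit one⁺ two⁻ _  _  = refl
∑-is12-orbit one⁻ two⁺ _  _  = refl
∑-is12-orbit one⁻ two⁻ _  _  = refl
∑-is12-orbit two⁺ one⁺ _  _  = refl
∑-is12-orbit two⁺ one⁻ _  _  = refl
∑-is12-orbit two⁻ one⁺ _  _  = refl
∑-is12-orbit two⁻ one⁻ _  _  = refl
∑-is12-orbit one⁺ one⁺ _  ()
∑-is12-orbit one⁺ one⁻ _  ()
∑-is12-orbit one⁻ one⁺ _  ()
∑-is12-orbit one⁻ one⁻ _  ()
∑-is12-orbit two⁺ two⁺ () _
∑-is12-orbit two⁺ two⁻ () _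
∑-is12-orbit two⁻ two⁺ () _
∑-is12-orbit two⁻ two⁻ () _

nonSmall-∣∣≢ : ∀ {x k} → ¬ Small x → Small (+ k) → (∣ x ∣ ℕ.≡ᵇ k) ≡ false
nonSmall-∣∣≢ {+ 0}                  ¬s one⁺ = refl
nonSmall-∣∣≢ {+ 0}                  ¬s two⁺ = refl
nonSmall-∣∣≢ {+ 1}                  ¬s _    = ⊥-elim (¬s one⁺)
nonSmall-∣∣≢ {+ 2}                  ¬s _    = ⊥-elim (¬s two⁺)
nonSmall-∣∣≢ {+ suc (suc (suc j))}  ¬s one⁺ = refl
nonSmall-∣∣≢ {+ suc (suc (suc j))}  ¬s two⁺ = refl
nonSmall-∣∣≢ { -[1+ 0 ] }           ¬s _    = ⊥-elim (¬s one⁻)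
nonSmall-∣∣≢ { -[1+ 1 ] }           ¬s _    = ⊥-elim (¬s two⁻)
nonSmall-∣∣≢ { -[1+ suc (suc j) ] } ¬s one⁺ = refl
nonSmall-∣∣≢ { -[1+ suc (suc j) ] } ¬s two⁺ = refl

has-smalls : ∀ {k} → Small (+ k) → ∀ l → has k l ≡ has k (smalls l)
has-smalls sk []      = refl
has-smalls sk (x ∷ l) with small? x
... | yes _  = cong (_ ∨_) (has-smalls sk l)
... | no ¬sx rewrite nonSmall-∣∣≢ ¬sx sk = has-smalls sk l

-- A signed permutation has exactly two small letters

∈-─ : {x y : ℕ} {xs : List ℕ} (x∈xs : x ∈ xs) → y ∈ xs → y ≢ x → y ∈ xs ─ x∈xs
∈-─ (here refl)  (here refl) y≢x = ⊥-elim (y≢x refl)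
∈-─ (here refl)  (there y∈)  y≢x = y∈
∈-─ (there x∈)   (here refl) y≢x = here refl
∈-─ (there x∈)   (there y∈)  y≢x = there (∈-─ x∈ y∈ y≢x)

cover : ∀ N (ks : List ℕ) → (∀ j → j < N → j ∈ ks) → N ≤ length ks
cover zero    ks covered = z≤n
cover (suc N) ks covered =
  subst (suc N ≤_) (sym (ListP.length-removeAt′ ks _))
    (s≤s (cover N (ks ─ N∈ks) (λ j j<N → ∈-─ N∈ks (covered j (ℕP.m<n⇒m<1+n j<N)) (ℕP.<⇒≢ j<N))))
  where
  N∈ks : N ∈ ks
  N∈ks = covered N (ℕP.n<1+n N)

module _ {A : Set} {P : A → Set} (P? : Decidable P) where

  cover-filter : (f : A → ℕ) (N : ℕ) (xs : List A) →
                 (∀ j → j < N → ∃[ x ] x ∈ xs × P x × f x ≡ j) → N ≤ length (filter P? xs)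
  cover-filter f N xs hit = subst (N ≤_) (ListP.length-map f (filter P? xs))
    (cover N (map f (filter P? xs)) λ j j<N →
      let x , x∈xs , px , fx≡j = hit j j<N in
      subst (_∈ map f (filter P? xs)) fx≡j (∈P.∈-map⁺ f (∈P.∈-filter⁺ P? x∈xs px)))

  length-filter-disjoint : {Q : A → Set} (Q? : Decidable Q) → (∀ {x} → P x → ¬ Q x) →
                           ∀ xs → length (filter P? xs) + length (filter Q? xs) ≤ length xs
  length-filter-disjoint Q? disj []       = z≤n
  length-filter-disjoint Q? disj (x ∷ xs) with P? x | Q? x | length-filter-disjoint Q? disj xs
  ... | yes px | yes qx | _  = ⊥-elim (disj px qx)
  ... | yes _  | no _   | ih = s≤s ih
  ... | no _   | yes _  | ih = subst (_≤ suc (length xs)) (sym (ℕP.+-suc _ _)) (s≤s ih)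
  ... | no _   | no _   | ih = ℕP.m≤n⇒m≤1+n ih

and-map-∈ : {A : Set} (f : A → Bool) {xs : List A} → and (map f xs) ≡ true → ∀ {x} → x ∈ xs → f x ≡ true
and-map-∈ f {y ∷ xs} all-f (here refl) = BoolP.∧-conicalˡ (f y) _ all-f
and-map-∈ f {y ∷ xs} all-f (there x∈)  = and-map-∈ f (BoolP.∧-conicalʳ (f y) _ all-f) x∈

signedPermᵇ-covers : ∀ n l → signedPermᵇ n l ≡ true → ∀ j → j < n → ∃[ x ] x ∈ l × ∣ x ∣ ≡ suc j
signedPermᵇ-covers n l sp j j<n
  with any? (λ x → ∣ x ∣ ℕ.≟ suc j) l | and-map-∈ (λ j → has (suc j) l) sp (∈P.∈-upTo⁺ j<n)
... | yes found | _ = find found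

Small-of-∣∣ : ∀ x {j} → ∣ x ∣ ≡ suc j → j < 2 → Small x
Small-of-∣∣ (+ 1)                 refl _                 = one⁺
Small-of-∣∣ (+ 2)                 refl _                 = two⁺
Small-of-∣∣ (+ suc (suc (suc k))) refl (s≤s (s≤s ()))
Small-of-∣∣ -[1+ 0 ]              refl _                 = one⁻
Small-of-∣∣ -[1+ 1 ]              refl _                 = two⁻
Small-of-∣∣ -[1+ suc (suc k) ]    refl (s≤s (s≤s ()))

Big-of-∣∣ : ∀ x {j} → ∣ x ∣ ≡ 3 + j → Big x
Big-of-∣∣ (+ suc (suc (suc k))) refl = big⁺ k
Big-of-∣∣ -[1+ suc (suc k) ]    refl = big⁻ k

Letter : ℤ → Set
Letter x = Small x ⊎ Big x

letter? : Decidable Letter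
letter? x = small? x ⊎-dec big? x

Letter-of-∣∣ : ∀ x {j} → ∣ x ∣ ≡ suc j → Letter x
Letter-of-∣∣ x {0}           e = inj₁ (Small-of-∣∣ x e (s≤s z≤n))
Letter-of-∣∣ x {1}           e = inj₁ (Small-of-∣∣ x e (s≤s (s≤s z≤n)))
Letter-of-∣∣ x {suc (suc j)} e = inj₂ (Big-of-∣∣ x e)

module SignedPermList (m : ℕ) (l : List ℤ) (len : length l ≡ 2 + m) (sp : signedPermᵇ (2 + m) l ≡ true) where

  All-Letter : All Letter l
  All-Letter = subst (All Letter) (ListP.filter-complete letter? filter-full) (all-filter letter? l)
    where
    filter-full : length (filter letter? l) ≡ length l
    filter-full = ℕP.≤-antisym (ListP.length-filter letter? l)
      (subst (_≤ length (filter letter? l)) (sym len)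
        (cover-filter letter? (λ x → ∣ x ∣ ∸ 1) (2 + m) l λ j j<n →
          let x , x∈l , ∣x∣≡1+j = signedPermᵇ-covers (2 + m) l sp j j<n in
          x , x∈l , Letter-of-∣∣ x ∣x∣≡1+j , cong (_∸ 1) ∣x∣≡1+j))

  length-smalls : length (smalls l) ≡ 2
  length-smalls = ℕP.≤-antisym at-most-2 at-least-2
    where
    at-least-2 : 2 ≤ length (smalls l)
    at-least-2 = cover-filter small? (λ x → ∣ x ∣ ∸ 1) 2 l λ j j<2 →
      let x , x∈l , ∣x∣≡1+j = signedPermᵇ-covers (2 + m) l sp j (ℕP.≤-trans j<2 (ℕP.m≤m+n 2 m)) in
      x , x∈l , Small-of-∣∣ x ∣x∣≡1+j j<2 , cong (_∸ 1) ∣x∣≡1+j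
    at-least-m-bigs : m ≤ length (filter big? l)
    at-least-m-bigs = cover-filter big? (λ x → ∣ x ∣ ∸ 3) m l λ j j<m →
      let x , x∈l , ∣x∣≡3+j = signedPermᵇ-covers (2 + m) l sp (2 + j) (s≤s (s≤s j<m)) in
      x , x∈l , Big-of-∣∣ x ∣x∣≡3+j , cong (_∸ 3) ∣x∣≡3+j
    at-most-2 : length (smalls l) ≤ 2
    at-most-2 = ℕP.+-cancelʳ-≤ m _ 2 (begin
      length (smalls l) + m                           ≤⟨ ℕP.+-monoʳ-≤ (length (smalls l)) at-least-m-bigs ⟩
      length (smalls l) + length (filter big? l)      ≤⟨ length-filter-disjoint small? big? Small⇒¬Big l ⟩
      length l                                        ≡⟨ len ⟩
      2 + m                                           ∎)
      where
      open ℕP.≤-Reasoning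
      Small⇒¬Big : ∀ {x} → Small x → ¬ Big x
      Small⇒¬Big one⁺ ()
      Small⇒¬Big one⁻ ()
      Small⇒¬Big two⁺ ()
      Small⇒¬Big two⁻ ()

∑-canonical-orbit : ∀ m l → length l ≡ 2 + m → signedPermᵇ (2 + m) l ≡ true →
                    ∑[ g ← allB₂ ] 𝟙 (does (canonical? (map (act g) l))) ≡ 1
∑-canonical-orbit m l len sp =
  trans (∑-cong allB₂ (λ g → cong (𝟙 ∘ does ∘ is12?) (smalls-act g l)))
        (orbit-of-two (smalls l) length-smalls (all-filter small? l) has₁ has₂)
  where
  open SignedPermList m l len sp
  has₁ : has 1 (smalls l) ≡ true
  has₁ = trans (sym (has-smalls one⁺ l)) (BoolP.∧-conicalˡ (has 1 l) _ sp)
  has₂ : has 2 (smalls l) ≡ true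
  has₂ = trans (sym (has-smalls two⁺ l)) (BoolP.∧-conicalˡ (has 2 l) _ (BoolP.∧-conicalʳ (has 1 l) _ sp))
  orbit-of-two : ∀ s → length s ≡ 2 → All Small s → has 1 s ≡ true → has 2 s ≡ true →
                 ∑[ g ← allB₂ ] 𝟙 (does (is12? (map (act g) s))) ≡ 1
  orbit-of-two (x ∷ y ∷ []) refl (sx ∷ sy ∷ []) = ∑-is12-orbit sx sy

lastOr : ℤ → List ℤ → ℤ
lastOr p []      = p
lastOr p (x ∷ l) = lastOr x l

descents-++ : ∀ p xs ys → descents p (xs ++ ys) ≡ descents p xs ++ descents (lastOr p xs) ys
descents-++ p []       ys = refl
descents-++ p (x ∷ xs) ys = cong (does (x <? p) ∷_) (descents-++ x xs ys)

Big<Small⇔neg : ∀ {c p} → Big c → Small p → does (c <? p) ≡ does (c <? + 0)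
Big<Small⇔neg (big⁺ k) one⁺ = refl
Big<Small⇔neg (big⁺ k) one⁻ = refl
Big<Small⇔neg (big⁺ k) two⁺ = refl
Big<Small⇔neg (big⁺ k) two⁻ = refl
Big<Small⇔neg (big⁻ k) one⁺ = refl
Big<Small⇔neg (big⁻ k) one⁻ = refl
Big<Small⇔neg (big⁻ k) two⁺ = refl
Big<Small⇔neg (big⁻ k) two⁻ = refl

Small<Big⇔pos : ∀ {p c} → Small p → Big c → does (p <? c) ≡ does (+ 0 <? c)
Small<Big⇔pos one⁺ (big⁺ k) = refl
Small<Big⇔pos one⁻ (big⁺ k) = refl
Small<Big⇔pos two⁺ (big⁺ k) = refl
Small<Big⇔pos two⁻ (big⁺ k) = refl
Small<Big⇔pos one⁺ (big⁻ k) = refl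
Small<Big⇔pos one⁻ (big⁻ k) = refl
Small<Big⇔pos two⁺ (big⁻ k) = refl
Small<Big⇔pos two⁻ (big⁻ k) = refl

Big-lastOr : ∀ {p l} → Big p → All Big l → Big (lastOr p l)
Big-lastOr bp []          = bp
Big-lastOr bp (bx ∷ bigs) = Big-lastOr bx bigs

descents-after-Small : ∀ {p l} → Small p → All Big l → descents p l ≡ descents (+ 0) l
descents-after-Small sp []          = refl
descents-after-Small sp (bx ∷ bigs) = cong (_∷ _) (Big<Small⇔neg bx sp)

map-act-Big : ∀ g {l} → All Big l → map (act g) l ≡ l
map-act-Big g []          = refl
map-act-Big g (bx ∷ bigs) = cong₂ _∷_ (act-Big g bx) (map-act-Big g bigs)

data CanonicalShape : List ℤ → Set where
  shape : ∀ {B C D} → All Big B → All Big C → All Big D → CanonicalShape (B ++ + 1 ∷ C ++ + 2 ∷ D)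

Big-of-Letter : ∀ {x} → Letter x → ¬ Small x → Big x
Big-of-Letter (inj₁ sx) ¬sx = ⊥-elim (¬sx sx)
Big-of-Letter (inj₂ bx) ¬sx = bx

All-Big-of-no-smalls : ∀ {l} → All Letter l → smalls l ≡ [] → All Big l
All-Big-of-no-smalls {[]}    []       _ = []
All-Big-of-no-smalls {x ∷ l} (lx ∷ L) e with small? x
... | no ¬sx = Big-of-Letter lx ¬sx ∷ All-Big-of-no-smalls L e

split-at-first-small : ∀ {l x s} → All Letter l → smalls l ≡ x ∷ s →
  ∃[ B ] ∃[ r ] l ≡ B ++ x ∷ r × All Big B × All Letter r × smalls r ≡ s
split-at-first-small {y ∷ l} (ly ∷ L) e with small? y
... | yes _  = [] , l , cong (_∷ l) (ListP.∷-injectiveˡ e) , [] , L , ListP.∷-injectiveʳ e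
... | no ¬sy with split-at-first-small L e
...   | B , r , l≡ , bigB , Lr , e′ = y ∷ B , r , cong (y ∷_) l≡ , Big-of-Letter ly ¬sy ∷ bigB , Lr , e′

canonicalShape : ∀ {l} → All Letter l → smalls l ≡ + 1 ∷ + 2 ∷ [] → CanonicalShape l
canonicalShape L e with split-at-first-small L e
... | B , r , refl , bigB , Lr , e′ with split-at-first-small Lr e′
...   | C , D , refl , bigC , LD , e″ = shape bigB bigC (All-Big-of-no-smalls LD e″)

descents-act-shape : ∀ g {B C D} → All Big B → All Big C → All Big D →
  descents (+ 0) (map (act g) (B ++ + 1 ∷ C ++ + 2 ∷ D)) ≡
  descents (+ 0) B ++ does (image₁ g <? lastOr (+ 0) B) ∷ descents (+ 0) C ++ does (image₂ g <? lastOr (image₁ g) C) ∷ descents (+ 0) D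
descents-act-shape g {B} {C} {D} bigB bigC bigD = begin
  descents (+ 0) (map (act g) (B ++ + 1 ∷ C ++ + 2 ∷ D))
    ≡⟨ cong (descents (+ 0)) acted ⟩
  descents (+ 0) (B ++ u ∷ C ++ v ∷ D)
    ≡⟨ descents-++ (+ 0) B _ ⟩
  descents (+ 0) B ++ does (u <? lastOr (+ 0) B) ∷ descents u (C ++ v ∷ D)
    ≡⟨ cong (λ ds → descents (+ 0) B ++ does (u <? lastOr (+ 0) B) ∷ ds) (descents-++ u C _) ⟩
  descents (+ 0) B ++ does (u <? lastOr (+ 0) B) ∷ descents u C ++ does (v <? lastOr u C) ∷ descents v D
    ≡⟨ cong₂ (λ dC dD → descents (+ 0) B ++ does (u <? lastOr (+ 0) B) ∷ dC ++ does (v <? lastOr u C) ∷ dD)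
             (descents-after-Small (Small-image₁ g) bigC) (descents-after-Small (Small-image₂ g) bigD) ⟩
  descents (+ 0) B ++ does (u <? lastOr (+ 0) B) ∷ descents (+ 0) C ++ does (v <? lastOr u C) ∷ descents (+ 0) D ∎
  where
  open ≡-Reasoning
  u = image₁ g
  v = image₂ g
  acted : map (act g) (B ++ + 1 ∷ C ++ + 2 ∷ D) ≡ B ++ u ∷ C ++ v ∷ D
  acted = trans (ListP.map-++ (act g) B _)
    (cong₂ _++_ (map-act-Big g bigB)
      (cong (u ∷_) (trans (ListP.map-++ (act g) C _)
        (cong₂ _++_ (map-act-Big g bigC) (cong (v ∷_) (map-act-Big g bigD))))))

-- Orbit sums modulo 4

if-eta : {A : Set} (h : Bool → A) (b : Bool) → h b ≡ (if b then h true else h false)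
if-eta h true  = refl
if-eta h false = refl

firstDescent secondDescent : B₂ → Bool
firstDescent  g = does (image₁ g <? + 0)
secondDescent g = does (image₂ g <? image₁ g)

∑-firstDescent-mod4 : (h : Bool → Bool) → (∑[ g ← allB₂ ] 𝟙 (h (firstDescent g))) % 4 ≡ 0
∑-firstDescent-mod4 h =
  trans (cong (_% 4) (∑-cong allB₂ (λ g → cong 𝟙 (if-eta h (firstDescent g))))) (table (h true) (h false))
  where
  table : ∀ a b → (∑[ g ← allB₂ ] 𝟙 (if firstDescent g then a else b)) % 4 ≡ 0
  table true  true  = refl
  table true  false = refl
  table false true  = refl
  table false false = refl

∑-secondDescent-mod4 : (h : Bool → Bool) → (∑[ g ← allB₂ ] 𝟙 (h (secondDescent g))) % 4 ≡ 0
∑-secondDescent-mod4 h =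
  trans (cong (_% 4) (∑-cong allB₂ (λ g → cong 𝟙 (if-eta h (secondDescent g))))) (table (h true) (h false))
  where
  table : ∀ a b → (∑[ g ← allB₂ ] 𝟙 (if secondDescent g then a else b)) % 4 ≡ 0
  table true  true  = refl
  table true  false = refl
  table false true  = refl
  table false false = refl

∑-constant-mod4 : (b : Bool) → (∑[ g ← allB₂ ] 𝟙 b) % 4 ≡ 0
∑-constant-mod4 true  = refl
∑-constant-mod4 false = refl

-- The orbit of the word 1 2 is the set of all signed permutations of size 2.
∑-descentPattern : ∀ s₁ s₂ E →
  ∑[ g ← allB₂ ] 𝟙 (does (firstDescent g Bool.≟ s₁) ∧ (does (secondDescent g Bool.≟ s₂) ∧ E)) ≡ βˢ 2 (s₁ ∷ s₂ ∷ []) * 𝟙 E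
∑-descentPattern true  true  true  = refl
∑-descentPattern true  true  false = refl
∑-descentPattern true  false true  = refl
∑-descentPattern true  false false = refl
∑-descentPattern false true  true  = refl
∑-descentPattern false true  false = refl
∑-descentPattern false false true  = refl
∑-descentPattern false false false = refl

residue : Bool → Bool → List Bool → List ℤ → ℕ
residue s₁ s₂ S (+ 1 ∷ + 2 ∷ D) = βˢ 2 (s₁ ∷ s₂ ∷ []) * 𝟙 (descents (+ 0) D == S)
residue s₁ s₂ S _                = 0

residue-Big₁ : ∀ {s₁ s₂ S c r} → Big c → residue s₁ s₂ S (c ∷ r) ≡ 0
residue-Big₁ (big⁺ k) = refl
residue-Big₁ (big⁻ k) = refl

residue-Big₂ : ∀ {s₁ s₂ S c r} → Big c → residue s₁ s₂ S (+ 1 ∷ c ∷ r) ≡ 0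
residue-Big₂ (big⁺ k) = refl
residue-Big₂ (big⁻ k) = refl

∑-orbit-descents-mod4 : ∀ s₁ s₂ S {l} → CanonicalShape l →
  (∑[ g ← allB₂ ] 𝟙 (descents (+ 0) (map (act g) l) == (s₁ ∷ s₂ ∷ S))) % 4 ≡ residue s₁ s₂ S l % 4
∑-orbit-descents-mod4 s₁ s₂ S (shape {B} {C} {D} bigB bigC bigD) =
  trans (cong (_% 4) (∑-cong allB₂ (λ g → cong (λ ds → 𝟙 (ds == S′)) (descents-act-shape g bigB bigC bigD))))
        (by-shape bigB bigC)
  where
  S′ = s₁ ∷ s₂ ∷ S
  dD = descents (+ 0) D
  by-shape : ∀ {B C} → All Big B → All Big C →
    (∑[ g ← allB₂ ] 𝟙 ((descents (+ 0) B ++ does (image₁ g <? lastOr (+ 0) B) ∷ descents (+ 0) C ++ does (image₂ g <? lastOr (image₁ g) C) ∷ dD) == S′)) % 4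
      ≡ residue s₁ s₂ S (B ++ + 1 ∷ C ++ + 2 ∷ D) % 4
  by-shape [] [] = cong (_% 4) (∑-descentPattern s₁ s₂ (dD == S))
  by-shape {C = c ∷ C} [] (bc ∷ bigC) = begin
    (∑[ g ← allB₂ ] 𝟙 ((firstDescent g ∷ dC ++ does (image₂ g <? lastOr c C) ∷ dD) == S′)) % 4
      ≡⟨ cong (_% 4) (∑-cong allB₂ (λ g → cong (λ b → 𝟙 ((firstDescent g ∷ dC ++ b ∷ dD) == S′))
                                             (Small<Big⇔pos (Small-image₂ g) (Big-lastOr bc bigC)))) ⟩
    (∑[ g ← allB₂ ] 𝟙 ((firstDescent g ∷ dC ++ does (+ 0 <? lastOr c C) ∷ dD) == S′)) % 4
      ≡⟨ ∑-firstDescent-mod4 (λ a → (a ∷ dC ++ does (+ 0 <? lastOr c C) ∷ dD) == S′) ⟩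
    0
      ≡⟨ cong (_% 4) (residue-Big₂ bc) ⟨
    residue s₁ s₂ S (+ 1 ∷ c ∷ C ++ + 2 ∷ D) % 4 ∎
    where
    open ≡-Reasoning
    dC = descents (+ 0) (c ∷ C)
  by-shape {B = b ∷ B} (bb ∷ bigB) [] = begin
    (∑[ g ← allB₂ ] 𝟙 ((dB ++ does (image₁ g <? lastOr b B) ∷ secondDescent g ∷ dD) == S′)) % 4
      ≡⟨ cong (_% 4) (∑-cong allB₂ (λ g → cong (λ a → 𝟙 ((dB ++ a ∷ secondDescent g ∷ dD) == S′))
                                             (Small<Big⇔pos (Small-image₁ g) (Big-lastOr bb bigB)))) ⟩
    (∑[ g ← allB₂ ] 𝟙 ((dB ++ does (+ 0 <? lastOr b B) ∷ secondDescent g ∷ dD) == S′)) % 4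
      ≡⟨ ∑-secondDescent-mod4 (λ a → (dB ++ does (+ 0 <? lastOr b B) ∷ a ∷ dD) == S′) ⟩
    0
      ≡⟨ cong (_% 4) (residue-Big₁ bb) ⟨
    residue s₁ s₂ S (b ∷ B ++ + 1 ∷ + 2 ∷ D) % 4 ∎
    where
    open ≡-Reasoning
    dB = descents (+ 0) (b ∷ B)
  by-shape {B = b ∷ B} {C = c ∷ C} (bb ∷ bigB) (bc ∷ bigC) = begin
    (∑[ g ← allB₂ ] 𝟙 ((dB ++ does (image₁ g <? lastOr b B) ∷ dC ++ does (image₂ g <? lastOr c C) ∷ dD) == S′)) % 4
      ≡⟨ cong (_% 4) (∑-cong allB₂ (λ g → cong₂ (λ a a′ → 𝟙 ((dB ++ a ∷ dC ++ a′ ∷ dD) == S′))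
                                             (Small<Big⇔pos (Small-image₁ g) (Big-lastOr bb bigB))
                                             (Small<Big⇔pos (Small-image₂ g) (Big-lastOr bc bigC)))) ⟩
    (∑[ g ← allB₂ ] 𝟙 ((dB ++ does (+ 0 <? lastOr b B) ∷ dC ++ does (+ 0 <? lastOr c C) ∷ dD) == S′)) % 4
      ≡⟨ ∑-constant-mod4 ((dB ++ does (+ 0 <? lastOr b B) ∷ dC ++ does (+ 0 <? lastOr c C) ∷ dD) == S′) ⟩
    0
      ≡⟨ cong (_% 4) (residue-Big₁ bb) ⟨
    residue s₁ s₂ S (b ∷ B ++ + 1 ∷ c ∷ C ++ + 2 ∷ D) % 4 ∎
    where
    open ≡-Reasoning
    dB = descents (+ 0) (b ∷ B)
    dC = descents (+ 0) (c ∷ C)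

canonicalResidue : ℕ → Bool → Bool → List Bool → List ℤ → ℕ
canonicalResidue n s₁ s₂ S l = residue s₁ s₂ S l * (𝟙 (does (canonical? l)) * 𝟙 (signedPermᵇ n l))

𝟙-weighted-mod4 : ∀ a b Σ h → (a ≡ true → b ≡ true → Σ % 4 ≡ h % 4) →
                  (𝟙 a * (𝟙 b * Σ)) % 4 ≡ (h * (𝟙 a * 𝟙 b)) % 4
𝟙-weighted-mod4 false b     Σ h _  = cong (_% 4) (sym (ℕP.*-zeroʳ h))
𝟙-weighted-mod4 true  false Σ h _  = cong (_% 4) (sym (ℕP.*-zeroʳ h))
𝟙-weighted-mod4 true  true  Σ h eq =
  trans (cong (_% 4) (trans (ℕP.*-identityˡ _) (ℕP.*-identityˡ Σ)))
        (trans (eq refl refl) (cong (_% 4) (sym (ℕP.*-identityʳ h))))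

does-true : {A : Set} (a? : Dec A) → does a? ≡ true → A
does-true (yes a) _ = a

canonical-orbit-sum-mod4 : ∀ m s₁ s₂ S l → length l ≡ 2 + m →
  (𝟙 (does (canonical? l)) * (∑[ g ← allB₂ ] βsummand (2 + m) (s₁ ∷ s₂ ∷ S) (map (act g) l))) % 4
    ≡ canonicalResidue (2 + m) s₁ s₂ S l % 4
canonical-orbit-sum-mod4 m s₁ s₂ S l len = begin
  (𝟙 (does (canonical? l)) * (∑[ g ← allB₂ ] βsummand (2 + m) S′ (map (act g) l))) % 4
    ≡⟨ cong (λ Σ → (𝟙 (does (canonical? l)) * Σ) % 4) (trans (∑-cong allB₂ βsummand-act) (∑-*ˡ (𝟙 (signedPermᵇ (2 + m) l)) descentTerm allB₂)) ⟩
  (𝟙 (does (canonical? l)) * (𝟙 (signedPermᵇ (2 + m) l) * ∑ descentTerm allB₂)) % 4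
    ≡⟨ 𝟙-weighted-mod4 (does (canonical? l)) (signedPermᵇ (2 + m) l) (∑ descentTerm allB₂) (residue s₁ s₂ S l) (λ canon sp →
         ∑-orbit-descents-mod4 s₁ s₂ S (canonicalShape (SignedPermList.All-Letter m l len sp) (does-true (canonical? l) canon))) ⟩
  canonicalResidue (2 + m) s₁ s₂ S l % 4 ∎
  where
  open ≡-Reasoning
  S′ = s₁ ∷ s₂ ∷ S
  descentTerm : B₂ → ℕ
  descentTerm g = 𝟙 (descents (+ 0) (map (act g) l) == S′)
  βsummand-act : ∀ g → βsummand (2 + m) S′ (map (act g) l) ≡ 𝟙 (signedPermᵇ (2 + m) l) * descentTerm g
  βsummand-act g = cong (λ b → 𝟙 b * descentTerm g) (signedPermᵇ-act g m l)

βsummand-canonical-split : ∀ m S l → length l ≡ 2 + m →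
  βsummand (2 + m) S l ≡ ∑[ g ← allB₂ ] βsummand (2 + m) S l * 𝟙 (does (canonical? (map (act g) l)))
βsummand-canonical-split m S l len =
  sym (trans (∑-*ˡ (βsummand (2 + m) S l) (λ g → 𝟙 (does (canonical? (map (act g) l)))) allB₂)
             (scaled (signedPermᵇ (2 + m) l) refl))
  where
  d = 𝟙 (descents (+ 0) l == S)
  scaled : ∀ b → signedPermᵇ (2 + m) l ≡ b →
           𝟙 b * d * (∑[ g ← allB₂ ] 𝟙 (does (canonical? (map (act g) l)))) ≡ 𝟙 b * d
  scaled false _  = refl
  scaled true  sp = trans (cong (𝟙 true * d *_) (∑-canonical-orbit m l len sp)) (ℕP.*-identityʳ (𝟙 true * d))

∑-B₂-inv : (f : B₂ → ℕ) → ∑ (f ∘ inv) allB₂ ≡ ∑ f allB₂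
∑-B₂-inv f = cong (λ r → f g₀ + (f g₁ + (f g₂ + (f g₃ + (f g₄ + r))))) (x∙yz≈y∙xz (f g₆) (f g₅) (f g₇ + 0))
  where
  g₀ = ⟨ false , false , false ⟩
  g₁ = ⟨ false , false , true ⟩
  g₂ = ⟨ false , true , false ⟩
  g₃ = ⟨ false , true , true ⟩
  g₄ = ⟨ true , false , false ⟩
  g₅ = ⟨ true , false , true ⟩
  g₆ = ⟨ true , true , false ⟩
  g₇ = ⟨ true , true , true ⟩

∑-words-act-substitution : ∀ m g (F c : List ℤ → ℕ) →
  ∑[ w ← words (2 + m) (letters (2 + m)) ] F (toList w) * c (map (act g) (toList w))
    ≡ ∑[ w ← words (2 + m) (letters (2 + m)) ] F (map (act (inv g)) (toList w)) * c (toList w)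
∑-words-act-substitution m g F c = sym (trans
  (∑-cong (words (2 + m) L) λ w → cong₂ (λ l l′ → F l * c l′) (sym (VecP.toList-map τ w)) (sym (act∘τ w)))
  (∑-words-permute τ L (∑-letters-act (inv g) m) (2 + m) (λ w → F (toList w) * c (map (act g) (toList w)))))
  where
  L = letters (2 + m)
  τ = act (inv g)
  act∘τ : ∀ w → map (act g) (toList (Vec.map τ w)) ≡ toList w
  act∘τ w = trans (cong (map (act g)) (VecP.toList-map τ w))
    (trans (sym (ListP.map-∘ (toList w))) (trans (ListP.map-cong (act-inv g) (toList w)) (ListP.map-id (toList w))))

residue-≢₁ : ∀ {s₁ s₂ S a r} → a ≢ + 1 → residue s₁ s₂ S (a ∷ r) ≡ 0
residue-≢₁ {a = + 0}           _   = refl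
residue-≢₁ {a = + 1}           a≢1 = ⊥-elim (a≢1 refl)
residue-≢₁ {a = + suc (suc k)} _   = refl
residue-≢₁ {a = -[1+ k ]}      _   = refl

residue-≢₂ : ∀ {s₁ s₂ S b r} → b ≢ + 2 → residue s₁ s₂ S (+ 1 ∷ b ∷ r) ≡ 0
residue-≢₂ {b = + 0}                 _   = refl
residue-≢₂ {b = + 1}                 _   = refl
residue-≢₂ {b = + 2}                 b≢2 = ⊥-elim (b≢2 refl)
residue-≢₂ {b = + suc (suc (suc k))} _   = refl
residue-≢₂ {b = -[1+ k ]}            _   = refl

∑-shift₂-vanishing : ∀ m (f : ℤ → ℕ) {k} → Small (+ k) → (∀ x → x ≢ + k → f x ≡ 0) → ∑ (f ∘ shift₂) (letters m) ≡ 0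
∑-shift₂-vanishing m f sk f≡0 = ∑-zero (letters m) λ x → f≡0 (shift₂ x) (λ eq → ¬Small-shift₂ x (subst Small (sym eq) sk))

∑-letters-point : ∀ m (f : ℤ → ℕ) {k} → Small (+ k) → (∀ x → x ≢ + k → f x ≡ 0) → ∑ f (letters (2 + m)) ≡ f (+ k)
∑-letters-point m f one⁺ f≡0 = trans (∑-letters-+2 m f)
  (trans (cong₂ (λ a r → f (+ 1) + (a + r)) (f≡0 _ λ ())
           (cong₂ _+_ (f≡0 _ λ ()) (cong₂ _+_ (f≡0 _ λ ()) (∑-shift₂-vanishing m f one⁺ f≡0))))
         (ℕP.+-identityʳ (f (+ 1))))
∑-letters-point m f two⁺ f≡0 = trans (∑-letters-+2 m f)
  (trans (cong₂ (λ a r → a + (f -[1+ 0 ] + (f (+ 2) + r))) (f≡0 _ λ ())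
           (cong₂ _+_ (f≡0 _ λ ()) (∑-shift₂-vanishing m f two⁺ f≡0)))
         (trans (cong (λ a → a + (f (+ 2) + 0)) (f≡0 _ λ ())) (ℕP.+-identityʳ (f (+ 2)))))

is12-longer : ∀ s → 0 < length s → does (is12? (+ 1 ∷ + 2 ∷ s)) ≡ false
is12-longer (x ∷ s) _ = refl

smalls-shift₂ : ∀ l → smalls (map shift₂ l) ≡ []
smalls-shift₂ []      = refl
smalls-shift₂ (x ∷ l) = trans (ListP.filter-reject small? (¬Small-shift₂ x)) (smalls-shift₂ l)

∣shift₂∣≡ᵇ : ∀ x k → (∣ shift₂ x ∣ ℕ.≡ᵇ 3 + k) ≡ (∣ x ∣ ℕ.≡ᵇ 1 + k)
∣shift₂∣≡ᵇ (+ zero)  k = refl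
∣shift₂∣≡ᵇ (+ suc j) k = refl
∣shift₂∣≡ᵇ -[1+ j ]  k = refl

has-shift₂ : ∀ k l → has (3 + k) (map shift₂ l) ≡ has (1 + k) l
has-shift₂ k []      = refl
has-shift₂ k (x ∷ l) = cong₂ _∨_ (∣shift₂∣≡ᵇ x k) (has-shift₂ k l)

signedPermᵇ-shift₂ : ∀ m l → signedPermᵇ (2 + m) (+ 1 ∷ + 2 ∷ map shift₂ l) ≡ signedPermᵇ m l
signedPermᵇ-shift₂ m l = cong and (begin
  map (λ j → has (suc j) l₁₂) (applyUpTo (λ k → 2 + k) m)  ≡⟨ cong (map _) (ListP.map-upTo (λ k → 2 + k) m) ⟨
  map (λ j → has (suc j) l₁₂) (map (λ k → 2 + k) (upTo m))  ≡⟨ ListP.map-∘ (upTo m) ⟨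
  map (λ k → has (3 + k) (map shift₂ l)) (upTo m)           ≡⟨ ListP.map-cong (λ k → has-shift₂ k l) (upTo m) ⟩
  map (λ k → has (suc k) l) (upTo m)                        ∎)
  where
  open ≡-Reasoning
  l₁₂ = + 1 ∷ + 2 ∷ map shift₂ l

shift₂-<? : ∀ x y → does (shift₂ x <? shift₂ y) ≡ does (x <? y)
shift₂-<? (+ zero)  (+ zero)  = refl
shift₂-<? (+ zero)  (+ suc b) = refl
shift₂-<? (+ zero)  -[1+ b ]  = refl
shift₂-<? (+ suc a) (+ zero)  = refl
shift₂-<? (+ suc a) (+ suc b) = refl
shift₂-<? (+ suc a) -[1+ b ]  = refl
shift₂-<? -[1+ a ]  (+ zero)  = refl
shift₂-<? -[1+ a ]  (+ suc b) = refl
shift₂-<? -[1+ a ]  -[1+ b ]  = refl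

descents-shift₂ : ∀ p l → descents (shift₂ p) (map shift₂ l) ≡ descents p l
descents-shift₂ p []      = refl
descents-shift₂ p (x ∷ l) = cong₂ _∷_ (shift₂-<? x p) (descents-shift₂ x l)

canonicalResidue-shift₂ : ∀ m s₁ s₂ S l →
  canonicalResidue (2 + m) s₁ s₂ S (+ 1 ∷ + 2 ∷ map shift₂ l) ≡ βˢ 2 (s₁ ∷ s₂ ∷ []) * βsummand m S l
canonicalResidue-shift₂ m s₁ s₂ S l = begin
  (β₂ * d′) * (𝟙 (does (is12? (+ 1 ∷ + 2 ∷ smalls (map shift₂ l)))) * 𝟙 sp′)
    ≡⟨ cong₂ (λ d c → (β₂ * 𝟙 d) * (𝟙 (does (is12? (+ 1 ∷ + 2 ∷ c))) * 𝟙 sp′))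
             (cong (_== S) (descents-shift₂ (+ 0) l)) (smalls-shift₂ l) ⟩
  (β₂ * 𝟙 d) * (1 * 𝟙 sp′)
    ≡⟨ cong ((β₂ * 𝟙 d) *_) (trans (ℕP.*-identityˡ (𝟙 sp′)) (cong 𝟙 (signedPermᵇ-shift₂ m l))) ⟩
  (β₂ * 𝟙 d) * 𝟙 sp
    ≡⟨ ℕP.*-assoc β₂ (𝟙 d) (𝟙 sp) ⟩
  β₂ * (𝟙 d * 𝟙 sp)
    ≡⟨ cong (β₂ *_) (ℕP.*-comm (𝟙 d) (𝟙 sp)) ⟩
  β₂ * βsummand m S l ∎
  where
  open ≡-Reasoning
  β₂ = βˢ 2 (s₁ ∷ s₂ ∷ [])
  d′ = 𝟙 (descents (+ 0) (map shift₂ l) == S)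
  d = descents (+ 0) l == S
  sp′ = signedPermᵇ (2 + m) (+ 1 ∷ + 2 ∷ map shift₂ l)
  sp = signedPermᵇ m l

∑-canonicalResidue : ∀ m s₁ s₂ (S : Vec Bool m) →
  ∑[ w ← words (2 + m) (letters (2 + m)) ] canonicalResidue (2 + m) s₁ s₂ (toList S) (toList w) ≡ βˢ 2 (s₁ ∷ s₂ ∷ []) * βˢ m S
∑-canonicalResidue m s₁ s₂ S = begin
  ∑[ w ← words (2 + m) L ] T (toList w)
    ≡⟨ ∑-words-suc (suc m) L _ ⟩
  ∑[ a ← L ] ∑[ w ← words (suc m) L ] T (a ∷ toList w)
    ≡⟨ ∑-cong L (λ a → ∑-words-suc m L _) ⟩
  ∑[ a ← L ] ∑[ b ← L ] ∑[ D ← words m L ] T (a ∷ b ∷ toList D)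
    ≡⟨ ∑-letters-point m (λ a → ∑[ b ← L ] ∑[ D ← words m L ] T (a ∷ b ∷ toList D)) one⁺
         (λ a a≢1 → ∑-zero L λ b → ∑-zero (words m L) λ D → T-≢₁ a≢1) ⟩
  ∑[ b ← L ] ∑[ D ← words m L ] T (+ 1 ∷ b ∷ toList D)
    ≡⟨ ∑-letters-point m (λ b → ∑[ D ← words m L ] T (+ 1 ∷ b ∷ toList D)) two⁺
         (λ b b≢2 → ∑-zero (words m L) λ D → T-≢₂ b≢2) ⟩
  ∑[ D ← words m L ] T₁₂ D
    ≡⟨ cong (λ L′ → ∑ T₁₂ (words m L′)) (letters-+2 m) ⟩
  ∑[ D ← words m (smallLetters ++ map shift₂ (letters m)) ] T₁₂ D
    ≡⟨ ∑-words-++-vanishing smallLetters _ (one⁺ ∷ one⁻ ∷ two⁺ ∷ two⁻ ∷ []) m T₁₂ T₁₂-vanishing ⟩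
  ∑[ D ← words m (map shift₂ (letters m)) ] T₁₂ D
    ≡⟨ ∑-words-map shift₂ (letters m) m T₁₂ ⟩
  ∑[ D ← words m (letters m) ] T₁₂ (Vec.map shift₂ D)
    ≡⟨ ∑-cong (words m (letters m)) (λ D → trans (cong (λ l → T (+ 1 ∷ + 2 ∷ l)) (VecP.toList-map shift₂ D))
                                                  (canonicalResidue-shift₂ m s₁ s₂ (toList S) (toList D))) ⟩
  ∑[ D ← words m (letters m) ] β₂ * βsummand m (toList S) (toList D)
    ≡⟨ ∑-*ˡ β₂ _ (words m (letters m)) ⟩
  β₂ * (∑[ D ← words m (letters m) ] βsummand m (toList S) (toList D))
    ≡⟨ cong (β₂ *_) (βˢ-as-∑ m S) ⟨
  β₂ * βˢ m S ∎
  where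
  open ≡-Reasoning
  L = letters (2 + m)
  β₂ = βˢ 2 (s₁ ∷ s₂ ∷ [])
  smallLetters = + 1 ∷ -[1+ 0 ] ∷ + 2 ∷ -[1+ 1 ] ∷ []
  T : List ℤ → ℕ
  T = canonicalResidue (2 + m) s₁ s₂ (toList S)
  T-≢₁ : ∀ {a r} → a ≢ + 1 → T (a ∷ r) ≡ 0
  T-≢₁ {a} {r} a≢1 = cong (_* (𝟙 (does (canonical? (a ∷ r))) * 𝟙 (signedPermᵇ (2 + m) (a ∷ r))))
                          (residue-≢₁ {s₁} {s₂} {toList S} {a} {r} a≢1)
  T-≢₂ : ∀ {b r} → b ≢ + 2 → T (+ 1 ∷ b ∷ r) ≡ 0
  T-≢₂ {b} {r} b≢2 = cong (_* (𝟙 (does (canonical? (+ 1 ∷ b ∷ r))) * 𝟙 (signedPermᵇ (2 + m) (+ 1 ∷ b ∷ r))))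
                          (residue-≢₂ {s₁} {s₂} {toList S} {b} {r} b≢2)
  T₁₂ : Vec ℤ m → ℕ
  T₁₂ D = T (+ 1 ∷ + 2 ∷ toList D)
  T₁₂-vanishing : ∀ D → Any Small (toList D) → T₁₂ D ≡ 0
  T₁₂-vanishing D small∈D = trans
    (cong (λ c → residue s₁ s₂ (toList S) (+ 1 ∷ + 2 ∷ toList D) * (𝟙 c * 𝟙 (signedPermᵇ (2 + m) (+ 1 ∷ + 2 ∷ toList D))))
          (is12-longer (smalls (toList D)) (ListP.filter-some small? small∈D)))
    (ℕP.*-zeroʳ (residue s₁ s₂ (toList S) (+ 1 ∷ + 2 ∷ toList D)))

β-orbit-decomposition : ∀ m (S : Vec Bool (2 + m)) →
  βˢ (2 + m) S ≡ ∑[ w ← words (2 + m) (letters (2 + m)) ]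
                   𝟙 (does (canonical? (toList w))) * (∑[ g ← allB₂ ] βsummand (2 + m) (toList S) (map (act g) (toList w)))
β-orbit-decomposition m S = begin
  βˢ (2 + m) S
    ≡⟨ βˢ-as-∑ (2 + m) S ⟩
  ∑[ w ← W ] F (toList w)
    ≡⟨ ∑-cong W (λ w → βsummand-canonical-split m (toList S) (toList w) (VecP.length-toList w)) ⟩
  ∑[ w ← W ] ∑[ g ← allB₂ ] F (toList w) * c (map (act g) (toList w))
    ≡⟨ ∑-comm (λ w g → F (toList w) * c (map (act g) (toList w))) W allB₂ ⟩
  ∑[ g ← allB₂ ] ∑[ w ← W ] F (toList w) * c (map (act g) (toList w))
    ≡⟨ ∑-cong allB₂ (λ g → ∑-words-act-substitution m g F c) ⟩
  ∑[ g ← allB₂ ] ∑[ w ← W ] F (map (act (inv g)) (toList w)) * c (toList w)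
    ≡⟨ ∑-comm (λ w g → F (map (act (inv g)) (toList w)) * c (toList w)) W allB₂ ⟨
  ∑[ w ← W ] ∑[ g ← allB₂ ] F (map (act (inv g)) (toList w)) * c (toList w)
    ≡⟨ ∑-cong W (λ w → factor-canonical (toList w)) ⟩
  ∑[ w ← W ] c (toList w) * (∑[ g ← allB₂ ] F (map (act g) (toList w))) ∎
  where
  open ≡-Reasoning
  W = words (2 + m) (letters (2 + m))
  F : List ℤ → ℕ
  F = βsummand (2 + m) (toList S)
  c : List ℤ → ℕ
  c = 𝟙 ∘ does ∘ canonical?
  factor-canonical : ∀ l → ∑[ g ← allB₂ ] F (map (act (inv g)) l) * c l ≡ c l * (∑[ g ← allB₂ ] F (map (act g) l))
  factor-canonical l = begin
    ∑[ g ← allB₂ ] F (map (act (inv g)) l) * c l    ≡⟨ ∑-cong allB₂ (λ g → ℕP.*-comm (F (map (act (inv g)) l)) (c l)) ⟩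
    ∑[ g ← allB₂ ] c l * F (map (act (inv g)) l)    ≡⟨ ∑-*ˡ (c l) (λ g → F (map (act (inv g)) l)) allB₂ ⟩
    c l * (∑[ g ← allB₂ ] F (map (act (inv g)) l))  ≡⟨ cong (c l *_) (∑-B₂-inv (λ g → F (map (act g) l))) ⟩
    c l * (∑[ g ← allB₂ ] F (map (act g) l))        ∎

β-recurrence-mod4 : ∀ m s₁ s₂ (S : Vec Bool m) →
  βˢ (2 + m) (s₁ ∷ s₂ ∷ S) % 4 ≡ (βˢ 2 (s₁ ∷ s₂ ∷ []) * βˢ m S) % 4
β-recurrence-mod4 m s₁ s₂ S = begin
  βˢ (2 + m) (s₁ ∷ s₂ ∷ S) % 4
    ≡⟨ cong (_% 4) (β-orbit-decomposition m (s₁ ∷ s₂ ∷ S)) ⟩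
  (∑[ w ← W ] 𝟙 (does (canonical? (toList w))) * (∑[ g ← allB₂ ] βsummand (2 + m) (s₁ ∷ s₂ ∷ toList S) (map (act g) (toList w)))) % 4
    ≡⟨ ∑-%-cong 4 W (λ w → canonical-orbit-sum-mod4 m s₁ s₂ (toList S) (toList w) (VecP.length-toList w)) ⟩
  (∑[ w ← W ] canonicalResidue (2 + m) s₁ s₂ (toList S) (toList w)) % 4
    ≡⟨ cong (_% 4) (∑-canonicalResidue m s₁ s₂ S) ⟩
  (βˢ 2 (s₁ ∷ s₂ ∷ []) * βˢ m S) % 4 ∎
  where
  open ≡-Reasoning
  W = words (2 + m) (letters (2 + m))

OddMod4 : ℕ → Set
OddMod4 x = x % 4 ≡ 1 ⊎ x % 4 ≡ 3

*-OddMod4 : ∀ {a b} → OddMod4 a → OddMod4 b → OddMod4 (a * b)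
*-OddMod4 {a} {b} oa ob = subst (λ r → r ≡ 1 ⊎ r ≡ 3) (sym (ℕD.%-distribˡ-* a b 4)) (odd·odd oa ob)
  where
  odd·odd : ∀ {x y} → x ≡ 1 ⊎ x ≡ 3 → y ≡ 1 ⊎ y ≡ 3 → OddMod4 (x * y)
  odd·odd (inj₁ refl) (inj₁ refl) = inj₁ refl
  odd·odd (inj₁ refl) (inj₂ refl) = inj₂ refl
  odd·odd (inj₂ refl) (inj₁ refl) = inj₂ refl
  odd·odd (inj₂ refl) (inj₂ refl) = inj₁ refl

βˢ-odd : ∀ n S → OddMod4 (βˢ n S)
βˢ-odd 0                []                = inj₁ refl
βˢ-odd 1                (true ∷ [])       = inj₁ refl
βˢ-odd 1                (false ∷ [])      = inj₁ refl
βˢ-odd (suc (suc m))    (s₁ ∷ s₂ ∷ S)     =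
  subst (λ r → r ≡ 1 ⊎ r ≡ 3) (sym (β-recurrence-mod4 m s₁ s₂ S)) (*-OddMod4 {βˢ 2 (s₁ ∷ s₂ ∷ [])} {βˢ m S} (βˢ₂-odd s₁ s₂) (βˢ-odd m S))
  where
  βˢ₂-odd : ∀ s₁ s₂ → OddMod4 (βˢ 2 (s₁ ∷ s₂ ∷ []))
  βˢ₂-odd true  true  = inj₁ refl
  βˢ₂-odd true  false = inj₂ refl
  βˢ₂-odd false true  = inj₂ refl
  βˢ₂-odd false false = inj₁ refl

βˢ-flip-first-mod4 : ∀ m s₂ (S : Vec Bool m) → (βˢ (2 + m) (true ∷ s₂ ∷ S) + 2) % 4 ≡ βˢ (2 + m) (false ∷ s₂ ∷ S) % 4
βˢ-flip-first-mod4 m s₂ S = begin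
  (βˢ (2 + m) (true ∷ s₂ ∷ S) + 2) % 4
    ≡⟨ ℕD.%-distribˡ-+ (βˢ (2 + m) (true ∷ s₂ ∷ S)) 2 4 ⟩
  (βˢ (2 + m) (true ∷ s₂ ∷ S) % 4 + 2) % 4
    ≡⟨ cong (λ r → (r + 2) % 4) (trans (β-recurrence-mod4 m true s₂ S) (ℕD.%-distribˡ-* (βˢ 2 (true ∷ s₂ ∷ [])) (βˢ m S) 4)) ⟩
  ((βˢ 2 (true ∷ s₂ ∷ []) % 4 * (βˢ m S % 4)) % 4 + 2) % 4
    ≡⟨ flip s₂ (βˢ-odd m S) ⟩
  (βˢ 2 (false ∷ s₂ ∷ []) % 4 * (βˢ m S % 4)) % 4
    ≡⟨ trans (β-recurrence-mod4 m false s₂ S) (ℕD.%-distribˡ-* (βˢ 2 (false ∷ s₂ ∷ [])) (βˢ m S) 4) ⟨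
  βˢ (2 + m) (false ∷ s₂ ∷ S) % 4 ∎
  where
  open ≡-Reasoning
  flip : ∀ s₂ {r} → r ≡ 1 ⊎ r ≡ 3 →
         ((βˢ 2 (true ∷ s₂ ∷ []) % 4 * r) % 4 + 2) % 4 ≡ (βˢ 2 (false ∷ s₂ ∷ []) % 4 * r) % 4
  flip true  (inj₁ refl) = refl
  flip true  (inj₂ refl) = refl
  flip false (inj₁ refl) = refl
  flip false (inj₂ refl) = refl

-- Divisibility by Φ₄

coeff-⊕ : ∀ p q k → coeff (p ⊕ q) k ≡ coeff p k ℤ.+ coeff q k
coeff-⊕ []      q       k       = sym (ℤP.+-identityˡ (coeff q k))
coeff-⊕ (a ∷ p) []      k       = sym (ℤP.+-identityʳ (coeff (a ∷ p) k))
coeff-⊕ (a ∷ p) (b ∷ q) zero    = refl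
coeff-⊕ (a ∷ p) (b ∷ q) (suc k) = coeff-⊕ p q k

coeff-scale : ∀ a q k → coeff (map (a ℤ.*_) q) k ≡ a ℤ.* coeff q k
coeff-scale a []      k       = sym (ℤP.*-zeroʳ a)
coeff-scale a (b ∷ q) zero    = refl
coeff-scale a (b ∷ q) (suc k) = coeff-scale a q k

coeff-⊛ : ∀ a p q k → coeff ((a ∷ p) ⊛ q) k ≡ a ℤ.* coeff q k ℤ.+ coeff (+ 0 ∷ (p ⊛ q)) k
coeff-⊛ a p q k = trans (coeff-⊕ (map (a ℤ.*_) q) _ k) (cong (ℤ._+ coeff (+ 0 ∷ (p ⊛ q)) k) (coeff-scale a q k))

coeff-Φ₄⊛ : ∀ q k → coeff (Φ₄ ⊛ q) k ≡ coeff q k ℤ.+ coeff (+ 0 ∷ + 0 ∷ q) k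
coeff-Φ₄⊛ q zero = trans (coeff-⊛ (+ 1) (+ 0 ∷ + 1 ∷ []) q 0) (cong (ℤ._+ + 0) (ℤP.*-identityˡ (coeff q 0)))
coeff-Φ₄⊛ q (suc zero) = begin
  coeff (Φ₄ ⊛ q) 1                              ≡⟨ coeff-⊛ (+ 1) (+ 0 ∷ + 1 ∷ []) q 1 ⟩
  + 1 ℤ.* coeff q 1 ℤ.+ coeff ((+ 0 ∷ + 1 ∷ []) ⊛ q) 0 ≡⟨ cong₂ ℤ._+_ (ℤP.*-identityˡ (coeff q 1)) (coeff-⊛ (+ 0) (+ 1 ∷ []) q 0) ⟩
  coeff q 1 ℤ.+ (+ 0 ℤ.+ + 0)                    ∎
  where open ≡-Reasoning
coeff-Φ₄⊛ q (suc (suc k)) = begin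
  coeff (Φ₄ ⊛ q) (2 + k)
    ≡⟨ coeff-⊛ (+ 1) (+ 0 ∷ + 1 ∷ []) q (2 + k) ⟩
  + 1 ℤ.* coeff q (2 + k) ℤ.+ coeff ((+ 0 ∷ + 1 ∷ []) ⊛ q) (1 + k)
    ≡⟨ cong₂ ℤ._+_ (ℤP.*-identityˡ (coeff q (2 + k))) (coeff-⊛ (+ 0) (+ 1 ∷ []) q (1 + k)) ⟩
  coeff q (2 + k) ℤ.+ (+ 0 ℤ.+ coeff ((+ 1 ∷ []) ⊛ q) k)
    ≡⟨ cong (ℤ._+_ (coeff q (2 + k))) (trans (ℤP.+-identityˡ (coeff ((+ 1 ∷ []) ⊛ q) k)) (coeff-⊛ (+ 1) [] q k)) ⟩
  coeff q (2 + k) ℤ.+ (+ 1 ℤ.* coeff q k ℤ.+ coeff (+ 0 ∷ []) k)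
    ≡⟨ cong (ℤ._+_ (coeff q (2 + k))) (cong₂ ℤ._+_ (ℤP.*-identityˡ (coeff q k)) (coeff-zero k)) ⟩
  coeff q (2 + k) ℤ.+ (coeff q k ℤ.+ + 0)
    ≡⟨ cong (ℤ._+_ (coeff q (2 + k))) (ℤP.+-identityʳ (coeff q k)) ⟩
  coeff q (2 + k) ℤ.+ coeff q k ∎
  where
  open ≡-Reasoning
  coeff-zero : ∀ k → coeff (+ 0 ∷ []) k ≡ + 0
  coeff-zero zero    = refl
  coeff-zero (suc k) = refl

neg : Poly → Poly
neg = map -_

coeff-neg : ∀ p k → coeff (neg p) k ≡ - coeff p k
coeff-neg []      k       = refl
coeff-neg (a ∷ p) zero    = refl
coeff-neg (a ∷ p) (suc k) = coeff-neg p k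

Φ₄∣-≈ : ∀ p q → (∀ k → coeff p k ≡ coeff q k) → Φ₄ ∣ₚ p → Φ₄ ∣ₚ q
Φ₄∣-≈ p q p≈q (r , p≈Φ₄r) = r , λ k → trans (sym (p≈q k)) (p≈Φ₄r k)

Φ₄∣-⊕ : ∀ p q → Φ₄ ∣ₚ p → Φ₄ ∣ₚ q → Φ₄ ∣ₚ (p ⊕ q)
Φ₄∣-⊕ p q (r , p≈) (r′ , q≈) = r ⊕ r′ , λ k → begin
  coeff (p ⊕ q) k
    ≡⟨ coeff-⊕ p q k ⟩
  coeff p k ℤ.+ coeff q k
    ≡⟨ cong₂ ℤ._+_ (trans (p≈ k) (coeff-Φ₄⊛ r k)) (trans (q≈ k) (coeff-Φ₄⊛ r′ k)) ⟩
  (coeff r k ℤ.+ coeff (+ 0 ∷ + 0 ∷ r) k) ℤ.+ (coeff r′ k ℤ.+ coeff (+ 0 ∷ + 0 ∷ r′) k)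
    ≡⟨ ℤ+.interchange (coeff r k) _ _ _ ⟩
  (coeff r k ℤ.+ coeff r′ k) ℤ.+ (coeff (+ 0 ∷ + 0 ∷ r) k ℤ.+ coeff (+ 0 ∷ + 0 ∷ r′) k)
    ≡⟨ cong₂ ℤ._+_ (coeff-⊕ r r′ k) (coeff-⊕ (+ 0 ∷ + 0 ∷ r) (+ 0 ∷ + 0 ∷ r′) k) ⟨
  coeff (r ⊕ r′) k ℤ.+ coeff (+ 0 ∷ + 0 ∷ (r ⊕ r′)) k
    ≡⟨ coeff-Φ₄⊛ (r ⊕ r′) k ⟨
  coeff (Φ₄ ⊛ (r ⊕ r′)) k ∎
  where open ≡-Reasoning

Φ₄∣-neg : ∀ p → Φ₄ ∣ₚ p → Φ₄ ∣ₚ neg p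
Φ₄∣-neg p (r , p≈) = neg r , λ k → begin
  coeff (neg p) k                                         ≡⟨ coeff-neg p k ⟩
  - coeff p k                                             ≡⟨ cong -_ (trans (p≈ k) (coeff-Φ₄⊛ r k)) ⟩
  - (coeff r k ℤ.+ coeff (+ 0 ∷ + 0 ∷ r) k)               ≡⟨ ℤP.neg-distrib-+ (coeff r k) _ ⟩
  - coeff r k ℤ.+ - coeff (+ 0 ∷ + 0 ∷ r) k               ≡⟨ cong₂ ℤ._+_ (coeff-neg r k) (coeff-neg (+ 0 ∷ + 0 ∷ r) k) ⟨
  coeff (neg r) k ℤ.+ coeff (+ 0 ∷ + 0 ∷ neg r) k         ≡⟨ coeff-Φ₄⊛ (neg r) k ⟨
  coeff (Φ₄ ⊛ neg r) k                                    ∎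
  where open ≡-Reasoning

t^ : ℕ → Poly
t^ = monomial

Φ₄∣t^a+t^[a+2] : ∀ a → Φ₄ ∣ₚ (t^ a ⊕ t^ (2 + a))
Φ₄∣t^a+t^[a+2] a = t^ a , λ k → trans (coeff-⊕ (t^ a) (t^ (2 + a)) k) (sym (coeff-Φ₄⊛ (t^ a) k))

Φ₄∣t^a+t^b⇒Φ₄∣t^b+t^a : ∀ a b → Φ₄ ∣ₚ (t^ a ⊕ t^ b) → Φ₄ ∣ₚ (t^ b ⊕ t^ a)
Φ₄∣t^a+t^b⇒Φ₄∣t^b+t^a a b = Φ₄∣-≈ (t^ a ⊕ t^ b) (t^ b ⊕ t^ a) λ k →
  trans (coeff-⊕ (t^ a) (t^ b) k) (trans (ℤP.+-comm (coeff (t^ a) k) _) (sym (coeff-⊕ (t^ b) (t^ a) k)))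

Φ₄∣t^a+t^b⇒Φ₄∣t^[a+4]+t^b : ∀ a b → Φ₄ ∣ₚ (t^ a ⊕ t^ b) → Φ₄ ∣ₚ (t^ (4 + a) ⊕ t^ b)
Φ₄∣t^a+t^b⇒Φ₄∣t^[a+4]+t^b a b Φ₄∣ab = Φ₄∣-≈ ((t^ a ⊕ t^ b) ⊕ (neg (t^ a ⊕ t^ (2 + a)) ⊕ (t^ (2 + a) ⊕ t^ (4 + a)))) (t^ (4 + a) ⊕ t^ b) rearranged
  (Φ₄∣-⊕ (t^ a ⊕ t^ b) _ Φ₄∣ab
    (Φ₄∣-⊕ (neg (t^ a ⊕ t^ (2 + a))) (t^ (2 + a) ⊕ t^ (4 + a)) (Φ₄∣-neg (t^ a ⊕ t^ (2 + a)) (Φ₄∣t^a+t^[a+2] a)) (Φ₄∣t^a+t^[a+2] (2 + a))))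
  where
  rearranged : ∀ k → coeff ((t^ a ⊕ t^ b) ⊕ (neg (t^ a ⊕ t^ (2 + a)) ⊕ (t^ (2 + a) ⊕ t^ (4 + a)))) k
                     ≡ coeff (t^ (4 + a) ⊕ t^ b) k
  rearranged k = begin
    coeff ((t^ a ⊕ t^ b) ⊕ (neg (t^ a ⊕ t^ (2 + a)) ⊕ (t^ (2 + a) ⊕ t^ (4 + a)))) k
      ≡⟨ coeff-⊕ (t^ a ⊕ t^ b) _ k ⟩
    coeff (t^ a ⊕ t^ b) k ℤ.+ coeff (neg (t^ a ⊕ t^ (2 + a)) ⊕ (t^ (2 + a) ⊕ t^ (4 + a))) k
      ≡⟨ cong₂ ℤ._+_ (coeff-⊕ (t^ a) (t^ b) k)
           (trans (coeff-⊕ (neg (t^ a ⊕ t^ (2 + a))) _ k)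
             (cong₂ ℤ._+_ (trans (coeff-neg (t^ a ⊕ t^ (2 + a)) k) (cong -_ (coeff-⊕ (t^ a) (t^ (2 + a)) k)))
                          (coeff-⊕ (t^ (2 + a)) (t^ (4 + a)) k))) ⟩
    (x ℤ.+ y) ℤ.+ (- (x ℤ.+ z) ℤ.+ (z ℤ.+ w))
      ≡⟨ ℤSolver.solve 4 (λ x y z w → (x :+ y) :+ (:- (x :+ z) :+ (z :+ w)) := w :+ y) refl x y z w ⟩
    w ℤ.+ y
      ≡⟨ coeff-⊕ (t^ (4 + a)) (t^ b) k ⟨
    coeff (t^ (4 + a) ⊕ t^ b) k ∎
    where
    open ≡-Reasoning
    open ℤSolver using (_:+_; :-_; _:=_)
    x = coeff (t^ a) k
    y = coeff (t^ b) k
    z = coeff (t^ (2 + a)) k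
    w = coeff (t^ (4 + a)) k

-- (4 + a + 2) % 4 reduces to (a + 2) % 4, so the hypothesis passes unchanged to the recursive calls.
Φ₄∣t^a+t^b : ∀ a b → (a + 2) % 4 ≡ b % 4 → Φ₄ ∣ₚ (t^ a ⊕ t^ b)
Φ₄∣t^a+t^b (suc (suc (suc (suc a)))) b e = Φ₄∣t^a+t^b⇒Φ₄∣t^[a+4]+t^b a b (Φ₄∣t^a+t^b a b e)
Φ₄∣t^a+t^b a (suc (suc (suc (suc b)))) e =
  Φ₄∣t^a+t^b⇒Φ₄∣t^b+t^a (4 + b) a (Φ₄∣t^a+t^b⇒Φ₄∣t^[a+4]+t^b b a (Φ₄∣t^a+t^b⇒Φ₄∣t^b+t^a a b (Φ₄∣t^a+t^b a b e)))
Φ₄∣t^a+t^b 0 2 _ = Φ₄∣t^a+t^[a+2] 0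
Φ₄∣t^a+t^b 1 3 _ = Φ₄∣t^a+t^[a+2] 1
Φ₄∣t^a+t^b 2 0 _ = Φ₄∣t^a+t^b⇒Φ₄∣t^b+t^a 0 2 (Φ₄∣t^a+t^[a+2] 0)
Φ₄∣t^a+t^b 3 1 _ = Φ₄∣t^a+t^b⇒Φ₄∣t^b+t^a 1 3 (Φ₄∣t^a+t^[a+2] 1)
Φ₄∣t^a+t^b 0 0 ()
Φ₄∣t^a+t^b 0 1 ()
Φ₄∣t^a+t^b 0 3 ()
Φ₄∣t^a+t^b 1 0 ()
Φ₄∣t^a+t^b 1 1 ()
Φ₄∣t^a+t^b 1 2 ()
Φ₄∣t^a+t^b 2 1 ()
Φ₄∣t^a+t^b 2 2 ()
Φ₄∣t^a+t^b 2 3 ()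
Φ₄∣t^a+t^b 3 0 ()
Φ₄∣t^a+t^b 3 2 ()
Φ₄∣t^a+t^b 3 3 ()

∑ₚ : {A : Set} → (A → Poly) → List A → Poly
∑ₚ f = List.foldr (λ x acc → f x ⊕ acc) []

module _ {A : Set} where

  Φ₄∣-∑ₚ : (f : A → Poly) → (∀ x → Φ₄ ∣ₚ f x) → ∀ xs → Φ₄ ∣ₚ ∑ₚ f xs
  Φ₄∣-∑ₚ f Φ₄∣f []       = [] , λ { 0 → refl ; 1 → refl ; 2 → refl ; (suc (suc (suc k))) → refl }
  Φ₄∣-∑ₚ f Φ₄∣f (x ∷ xs) = Φ₄∣-⊕ (f x) (∑ₚ f xs) (Φ₄∣f x) (Φ₄∣-∑ₚ f Φ₄∣f xs)

  coeff-∑ₚ-++ : ∀ (f : A → Poly) xs ys k → coeff (∑ₚ f (xs ++ ys)) k ≡ coeff (∑ₚ f xs) k ℤ.+ coeff (∑ₚ f ys) k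
  coeff-∑ₚ-++ f []       ys k = sym (ℤP.+-identityˡ _)
  coeff-∑ₚ-++ f (x ∷ xs) ys k = begin
    coeff (f x ⊕ ∑ₚ f (xs ++ ys)) k                                  ≡⟨ coeff-⊕ (f x) _ k ⟩
    coeff (f x) k ℤ.+ coeff (∑ₚ f (xs ++ ys)) k                      ≡⟨ cong (ℤ._+_ (coeff (f x) k)) (coeff-∑ₚ-++ f xs ys k) ⟩
    coeff (f x) k ℤ.+ (coeff (∑ₚ f xs) k ℤ.+ coeff (∑ₚ f ys) k)       ≡⟨ ℤP.+-assoc (coeff (f x) k) _ _ ⟨
    (coeff (f x) k ℤ.+ coeff (∑ₚ f xs) k) ℤ.+ coeff (∑ₚ f ys) k       ≡⟨ cong (ℤ._+ coeff (∑ₚ f ys) k) (coeff-⊕ (f x) (∑ₚ f xs) k) ⟨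
    coeff (f x ⊕ ∑ₚ f xs) k ℤ.+ coeff (∑ₚ f ys) k                    ∎
    where open ≡-Reasoning

  coeff-∑ₚ-⊕ : ∀ (f g : A → Poly) xs k → coeff (∑ₚ (λ x → f x ⊕ g x) xs) k ≡ coeff (∑ₚ f xs) k ℤ.+ coeff (∑ₚ g xs) k
  coeff-∑ₚ-⊕ f g []       k = refl
  coeff-∑ₚ-⊕ f g (x ∷ xs) k = begin
    coeff ((f x ⊕ g x) ⊕ ∑ₚ (λ x → f x ⊕ g x) xs) k
      ≡⟨ coeff-⊕ (f x ⊕ g x) _ k ⟩
    coeff (f x ⊕ g x) k ℤ.+ coeff (∑ₚ (λ x → f x ⊕ g x) xs) k
      ≡⟨ cong₂ ℤ._+_ (coeff-⊕ (f x) (g x) k) (coeff-∑ₚ-⊕ f g xs k) ⟩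
    (coeff (f x) k ℤ.+ coeff (g x) k) ℤ.+ (coeff (∑ₚ f xs) k ℤ.+ coeff (∑ₚ g xs) k)
      ≡⟨ ℤ+.interchange (coeff (f x) k) _ _ _ ⟩
    (coeff (f x) k ℤ.+ coeff (∑ₚ f xs) k) ℤ.+ (coeff (g x) k ℤ.+ coeff (∑ₚ g xs) k)
      ≡⟨ cong₂ ℤ._+_ (coeff-⊕ (f x) (∑ₚ f xs) k) (coeff-⊕ (g x) (∑ₚ g xs) k) ⟨
    coeff (f x ⊕ ∑ₚ f xs) k ℤ.+ coeff (g x ⊕ ∑ₚ g xs) k ∎
    where open ≡-Reasoning

∑ₚ-map : {A B : Set} (f : B → Poly) (g : A → B) (xs : List A) → ∑ₚ f (map g xs) ≡ ∑ₚ (f ∘ g) xs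
∑ₚ-map f g []       = refl
∑ₚ-map f g (x ∷ xs) = cong (f (g x) ⊕_) (∑ₚ-map f g xs)

coeff-∑ₚ-subsets-suc : ∀ n (f : Vec Bool (suc n) → Poly) k →
  coeff (∑ₚ f (subsets (suc n))) k ≡ coeff (∑ₚ (λ S → f (true ∷ S) ⊕ f (false ∷ S)) (subsets n)) k
coeff-∑ₚ-subsets-suc n f k = begin
  coeff (∑ₚ f (map (true ∷_) W ++ map (false ∷_) W ++ [])) k
    ≡⟨ coeff-∑ₚ-++ f (map (true ∷_) W) _ k ⟩
  coeff (∑ₚ f (map (true ∷_) W)) k ℤ.+ coeff (∑ₚ f (map (false ∷_) W ++ [])) k
    ≡⟨ cong₂ (λ p q → coeff p k ℤ.+ coeff q k) (∑ₚ-map f (true ∷_) W)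
             (trans (cong (∑ₚ f) (ListP.++-identityʳ (map (false ∷_) W))) (∑ₚ-map f (false ∷_) W)) ⟩
  coeff (∑ₚ (f ∘ (true ∷_)) W) k ℤ.+ coeff (∑ₚ (f ∘ (false ∷_)) W) k
    ≡⟨ coeff-∑ₚ-⊕ (f ∘ (true ∷_)) (f ∘ (false ∷_)) W k ⟨
  coeff (∑ₚ (λ S → f (true ∷ S) ⊕ f (false ∷ S)) W) k ∎
  where
  open ≡-Reasoning
  W = subsets n

theorem8p1 : (n : ℕ) → 2 ≤ n → Φ₄ ∣ₚ Qˢ n
theorem8p1 (suc (suc m)) (s≤s (s≤s z≤n)) =
  Φ₄∣-≈ (∑ₚ pair (subsets (suc m))) (Qˢ (2 + m)) (λ k → sym (coeff-∑ₚ-subsets-suc (suc m) (t^ ∘ βˢ (2 + m)) k))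
        (Φ₄∣-∑ₚ pair Φ₄∣pair (subsets (suc m)))
  where
  pair : Vec Bool (suc m) → Poly
  pair S = t^ (βˢ (2 + m) (true ∷ S)) ⊕ t^ (βˢ (2 + m) (false ∷ S))
  Φ₄∣pair : ∀ S → Φ₄ ∣ₚ pair S
  Φ₄∣pair (s₂ ∷ S) = Φ₄∣t^a+t^b (βˢ (2 + m) (true ∷ s₂ ∷ S)) (βˢ (2 + m) (false ∷ s₂ ∷ S)) (βˢ-flip-first-mod4 m s₂ S)
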